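{- Let $F(x)\in\mathbb{Z}[x]$ be nonconstant, let $q$ be a positive integer, $w$ an integer and $J$ a positive integer. Let $M=M(F,q)$ be the largest positive divisor of $q$ such that $F(v)\equiv F(1)\pmod M$ for all integers $v$ coprime to $M$. Let $\ell$ be a prime dividing $q$, let $e\ge1$ satisfy $\ell^e\,\|\,q$, and let $D_\ell\ge 0$ be the exponent of $\ell$ in $M$. For $1\le k\le e$ put $$H(\ell,k,J)=\sum_{\substack{0<r<\ell^k\\ \ell\nmid r}}\exp\!\left(\frac{ -2\pi i r w}{\ell^k}\right)\left[\frac{1}{\varphi(\ell^k)}\sum_{\substack{v\bmod \ell^k\\(v,\ell)=1}}\exp\!\left(\frac{2\pi i rF(v)}{\ell^k}\right)\right]^J,$$ and let $X_\ell=\Big\{k\in\mathbb{Z}\cap[1,e]:\ \Big|\sum_{v\bmod \ell^k,\,(v,\ell)=1}\exp\big(\tfrac{2\pi i F(v)}{\ell^k}\big)\Big|=\varphi(\ell^k)\Big\}$. Then $$\sum_{k\in X_\ell}H(\ell,k,J)=\begin{cases}0 & \text{if } \ell\nmid M,\\ \ell^{D_\ell}-1 & \text{if } \ell\mid M \text{ and } F(1)J\equiv w\pmod{\ell^{D_\ell}},\\ -1 & \text{otherwise.}\end{cases}$$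
   Context: $\varphi$ is Euler's totient function. -}

module Defs where

open import Data.Nat as ℕ using (ℕ; zero; suc; _∸_; _^_; _≤_; _<_)
open import Data.Nat.Divisibility using (_∣_; _∣?_)
open import Data.Nat.GCD using (gcd)
open import Data.Nat.Coprimality using (Coprime)
open import Data.Integer as ℤ using (ℤ; +_)
open import Data.Integer.Divisibility as ℤD using ()
open import Data.Rational as ℚ using (ℚ; 0ℚ; 1ℚ)
open import Data.List using (List; []; _∷_; _++_; map; concatMap; filter; length; upTo; foldr; [_])
open import Data.Product using (_×_; _,_; ∃)
open import Relation.Nullary using (¬_; ¬?)
open import Relation.Binary.PropositionalEquality using (_≡_)

-- Integer polynomials: coefficient lists, constant term first.

Poly : Set
Poly = List ℤ

eval : Poly → ℤ → ℤ
eval []       x = + 0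
eval (c ∷ cs) x = c ℤ.+ x ℤ.* eval cs x

coeffAt : Poly → ℕ → ℤ
coeffAt []       _       = + 0
coeffAt (c ∷ cs) zero    = c
coeffAt (c ∷ cs) (suc i) = coeffAt cs i

Nonconstant : Poly → Set
Nonconstant F = ∃ λ i → 1 ≤ i × ¬ (coeffAt F i ≡ + 0)

φ : ℕ → ℕ
φ n = length (filter (λ v → gcd v n ℕ.≟ 1) (upTo n))

GoodMod : Poly → ℕ → Set
GoodMod F m = ∀ (v : ℤ) → Coprime ℤ.∣ v ∣ m → (+ m) ℤD.∣ (eval F v ℤ.- eval F (+ 1))

IsM : Poly → ℕ → ℕ → Set
IsM F q M = 1 ≤ M × M ∣ q × GoodMod F M
          × (∀ m → 1 ≤ m → m ∣ q → GoodMod F m → m ≤ M)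

-- The cyclotomic field ℚ(ζ), ζ = exp(2πi/L), L = ℓ^e (ℓ prime, e ≥ 1),
-- realised exactly as ℚ[x]/(Φ_L(x)).
-- An element is a formal finite sum  Σ c·ζ^a  given as a list of (c , a),
-- c ∈ ℚ, a ∈ ℤ.  Then exp(2πi a / ℓ^k) = ζ^(a·ℓ^(e-k)) for k ≤ e.

Cyc : Set
Cyc = List (ℚ × ℤ)

ζ^ : ℤ → Cyc
ζ^ a = [ (1ℚ , a) ]

const : ℚ → Cyc
const c = [ (c , + 0) ]

_⊕_ : Cyc → Cyc → Cyc
_⊕_ = _++_

scale : ℚ → Cyc → Cyc
scale d = map (λ { (c , a) → (d ℚ.* c , a) })

neg : Cyc → Cyc
neg = scale (ℚ.- 1ℚ)

_⊗_ : Cyc → Cyc → Cyc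
x ⊗ y = concatMap (λ { (c , a) → map (λ { (d , b) → (c ℚ.* d , a ℤ.+ b) }) y }) x

conj : Cyc → Cyc
conj = map (λ { (c , a) → (c , ℤ.- a) })

pow : Cyc → ℕ → Cyc
pow x zero    = const 1ℚ
pow x (suc n) = x ⊗ pow x n

Σ[_]_ : {A : Set} → List A → (A → Cyc) → Cyc
Σ[ xs ] f = concatMap f xs

sumℚ : List ℚ → ℚ
sumℚ = foldr ℚ._+_ 0ℚ

-- coefficient of x^j (0 ≤ j < L) after reducing exponents mod x^L - 1
coeff : ℕ → Cyc → ℕ → ℚ
coeff L x j = sumℚ (map (λ { (c , a) → c })
                   (filter (λ { (c , a) → L ∣? ℤ.∣ a ℤ.- + j ∣ }) x))

Φ : ℕ → ℕ → Cyc
Φ ℓ e = map (λ t → (1ℚ , + (t ℕ.* ℓ ^ (e ∸ 1)))) (upTo ℓ)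

-- equality in ℚ(ζ_{ℓ^e}) ≅ ℚ[x]/(Φ_{ℓ^e}):
-- x - y ≡ h·Φ  modulo x^L - 1 (Φ divides x^L - 1) for some h.
Eq : ℕ → ℕ → Cyc → Cyc → Set
Eq ℓ e x y = ∃ λ (h : Cyc) → ∀ j → j < ℓ ^ e →
  coeff (ℓ ^ e) (x ⊕ neg y) j ≡ coeff (ℓ ^ e) (h ⊗ Φ ℓ e) j

-- 1/n for n ≥ 1 (only used with n = φ(ℓ^k) ≥ 1)
recip : ℕ → ℚ
recip zero    = 0ℚ
recip (suc n) = (+ 1) ℚ./ suc n

ex : (ℓ e k : ℕ) → ℤ → Cyc
ex ℓ e k a = ζ^ (a ℤ.* + (ℓ ^ (e ∸ k)))

unitsMod : ℕ → ℕ → List ℕ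
unitsMod ℓ k = filter (λ v → ¬? (ℓ ∣? v)) (upTo (ℓ ^ k))

rRange : ℕ → ℕ → List ℕ
rRange ℓ k = filter (λ r → ¬? (ℓ ∣? r)) (filter (λ r → 1 ℕ.≤? r) (upTo (ℓ ^ k)))

Ssum : Poly → (ℓ e k : ℕ) → ℤ → Cyc
Ssum F ℓ e k r = Σ[ unitsMod ℓ k ] (λ v → ex ℓ e k (r ℤ.* eval F (+ v)))

H : Poly → ℤ → (ℓ e k J : ℕ) → Cyc
H F w ℓ e k J = Σ[ rRange ℓ k ] (λ r →
  ex ℓ e k (ℤ.- (+ r ℤ.* w)) ⊗ pow (scale (recip (φ (ℓ ^ k))) (Ssum F ℓ e k (+ r))) J)

-- |Σ_{v mod ℓ^k,(v,ℓ)=1} exp(2πi F(v)/ℓ^k)| = φ(ℓ^k), expressed as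
-- S·conj(S) = φ(ℓ^k)²  (equivalent as |S| ≥ 0).
InX : Poly → (ℓ e k : ℕ) → Set
InX F ℓ e k = Eq ℓ e (Ssum F ℓ e k (+ 1) ⊗ conj (Ssum F ℓ e k (+ 1)))
                     (const (+ (φ (ℓ ^ k) ℕ.* φ (ℓ ^ k)) ℚ./ 1))

-- Let L = ℓ^e, ζ = exp(2πi/L) and n = F(1)J - w. The Gauss sum S_k = Σ_{v unit mod ℓ^k} ζ^(F(v)ℓ^(e-k))
-- has |S_k| = φ(ℓ^k) exactly when F is constant mod ℓ^k on units (for "only if", apply to S_k·S̄_k the
-- linear form τ(ζ^a) = ℓ·[L ∣ a] - [ℓ^(e-1) ∣ a], well defined on ℚ(ζ), which on powers of ζ attains its
-- maximum ℓ - 1 only at 1), and by the maximality of M this happens exactly when k ≤ D; so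
-- X_ℓ = {1, …, D}. For such k, S_k(r) = φ(ℓ^k)·ζ^(rF(1)ℓ^(e-k)), hence
-- H(ℓ,k,J) = Σ_{r < ℓ^k, ℓ ∤ r} ζ^(rnℓ^(e-k)), and the sum over k ≤ D telescopes to G_D - G_0 with
-- G_k = Σ_{r < ℓ^k} ζ^(rnℓ^(e-k)). Now G_0 = 1 and G_D = ℓ^D when ℓ^D ∣ n. Otherwise the exponents of
-- G_D are stable under adding nℓ^(e-D) and L, hence (Bézout) under adding ℓ^(e-1): its coefficients are
-- ℓ^(e-1)-periodic, so G_D is a multiple of Φ_L = Σ_{t<ℓ} ζ^(tℓ^(e-1)), i.e. G_D = 0.

module Submission where

open import Defs
open import Data.Nat as ℕ using (ℕ; zero; suc; _^_; _≤_; _<_; _∸_; z≤n; s≤s; NonZero)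
import Data.Nat.Properties as ℕP
open import Data.Nat.ListAction using (sum)
open import Data.Nat.Divisibility as ℕD using (_∣_; _∣?_; divides)
import Data.Nat.Coprimality as ℕC
open import Data.Nat.Coprimality using (Coprime)
open import Data.Nat.GCD using (gcd; module Bézout)
open import Data.Nat.Primality using (Prime; prime⇒irreducible; prime⇒nonZero; prime⇒nonTrivial)
open import Data.Integer as ℤ using (ℤ; +_; -[1+_])
import Data.Integer.Properties as ℤP
import Data.Integer.DivMod as ℤDM
import Data.Integer.Divisibility as ℤD
import Data.Integer.Divisibility.Signed as ℤS
open import Data.Integer.Tactic.RingSolver using (solve-∀)
open import Data.Rational as ℚ using (ℚ; 0ℚ; 1ℚ; mkℚ; _+_; _*_; -_; _-_)
import Data.Rational.Properties as ℚP
open import Data.Rational.Solver using (module +-*-Solver)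
open import Data.List as List using (List; []; _∷_; _++_; [_]; map; filter; upTo; length)
import Data.List.Properties as ListP
import Data.List.Membership.Propositional.Properties as ∈P
open import Data.List.Membership.Propositional using (_∈_)
open import Data.List.Relation.Unary.Any using (here; there)
open import Data.List.Relation.Unary.Unique.Propositional using (Unique)
import Data.List.Relation.Unary.Unique.Propositional.Properties as Unique
open import Data.List.Relation.Binary.Permutation.Propositional as ↭ using (_↭_)
open import Data.List.Relation.Binary.BagAndSetEquality using (∼bag⇒↭)
open import Data.List.Membership.Propositional.Properties.WithK using (unique∧set⇒bag)
open import Function.Bundles using (_⇔_; mk⇔; Equivalence)
open import Data.Product using (_×_; _,_; ∃; ∃₂; proj₁; proj₂)
open import Data.Sum using (inj₁; inj₂)
open import Data.Empty using (⊥-elim)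
open import Relation.Nullary using (¬_; yes; no; ¬?)
open import Relation.Unary using (Decidable)
open import Relation.Binary.PropositionalEquality hiding ([_])
open import Function using (_∘_)

open +-*-Solver using (solve; _:+_; _:*_; :-_; _:=_; con)

ιℤ : ℤ → ℚ
ιℤ z = z ℚ./ 1

ι : ℕ → ℚ
ι n = ιℤ (+ n)

private
  coprime-1 : ∀ n → ℕC.Coprime n 1
  coprime-1 n (_ , d∣1) = ℕD.∣1⇒≡1 d∣1

ιℤ≡mkℚ : ∀ z → ιℤ z ≡ mkℚ z 0 (coprime-1 ℤ.∣ z ∣)
ιℤ≡mkℚ z = ℚP.↥p/↧p≡p (mkℚ z 0 (coprime-1 ℤ.∣ z ∣))

ιℤ-+ : ∀ a b → ιℤ (a ℤ.+ b) ≡ ιℤ a + ιℤ b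
ιℤ-+ a b = trans (ℚP./-cong {a ℤ.+ b} {1} {a ℤ.* + 1 ℤ.+ b ℤ.* + 1} {1} (ab≡ a b) refl)
                 (sym (cong₂ _+_ (ιℤ≡mkℚ a) (ιℤ≡mkℚ b)))
  where
  ab≡ : ∀ a b → a ℤ.+ b ≡ a ℤ.* + 1 ℤ.+ b ℤ.* + 1
  ab≡ = solve-∀

ιℤ-* : ∀ a b → ιℤ (a ℤ.* b) ≡ ιℤ a * ιℤ b
ιℤ-* a b = sym (cong₂ _*_ (ιℤ≡mkℚ a) (ιℤ≡mkℚ b))

ι-+ : ∀ m n → ι (m ℕ.+ n) ≡ ι m + ι n
ι-+ m n = ιℤ-+ (+ m) (+ n)

ι-* : ∀ m n → ι (m ℕ.* n) ≡ ι m * ι n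
ι-* m n = trans (cong ιℤ (ℤP.pos-* m n)) (ιℤ-* (+ m) (+ n))

ι≡0⇒≡0 : ∀ n → ι n ≡ 0ℚ → n ≡ 0
ι≡0⇒≡0 n eq = ℤP.+-injective (cong ℚ.↥_ (trans (sym (ιℤ≡mkℚ (+ n))) (trans eq (ιℤ≡mkℚ (+ 0)))))

recip-*-ι : ∀ n → 1 ≤ n → recip n * ι n ≡ 1ℚ
recip-*-ι (suc n) _ =
  trans (cong₂ _*_ (ℚP.normalize-coprime 1⊥n) (ιℤ≡mkℚ (+ suc n))) (ℚP.*-inverseˡ (mkℚ (+ suc n) 0 (coprime-1 (suc n))))
  where
  1⊥n : ℕC.Coprime 1 (suc n)
  1⊥n (d∣1 , _) = ℕD.∣1⇒≡1 d∣1

∑ : {A : Set} → List A → (A → ℚ) → ℚ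
∑ xs f = sumℚ (map f xs)

module _ {A : Set} where

  ∑-cong : ∀ (xs : List A) {f g} → (∀ x → f x ≡ g x) → ∑ xs f ≡ ∑ xs g
  ∑-cong [] _ = refl
  ∑-cong (x ∷ xs) f≗g = cong₂ _+_ (f≗g x) (∑-cong xs f≗g)

  ∑-cong-∈ : ∀ (xs : List A) {f g} → (∀ {x} → x ∈ xs → f x ≡ g x) → ∑ xs f ≡ ∑ xs g
  ∑-cong-∈ [] _ = refl
  ∑-cong-∈ (x ∷ xs) f≗g = cong₂ _+_ (f≗g (here refl)) (∑-cong-∈ xs (λ x∈ → f≗g (there x∈)))

  ∑-++ : ∀ (xs ys : List A) f → ∑ (xs ++ ys) f ≡ ∑ xs f + ∑ ys f
  ∑-++ [] ys f = sym (ℚP.+-identityˡ _)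
  ∑-++ (x ∷ xs) ys f = trans (cong (λ t → f x + t) (∑-++ xs ys f)) (sym (ℚP.+-assoc (f x) _ _))

  ∑-+ : ∀ (xs : List A) f g → ∑ xs (λ x → f x + g x) ≡ ∑ xs f + ∑ xs g
  ∑-+ [] f g = sym (ℚP.+-identityˡ _)
  ∑-+ (x ∷ xs) f g = trans (cong (λ t → f x + g x + t) (∑-+ xs f g)) (swap (f x) (g x) (∑ xs f) (∑ xs g))
    where
    swap : ∀ a b c d → (a + b) + (c + d) ≡ (a + c) + (b + d)
    swap = solve 4 (λ a b c d → (a :+ b) :+ (c :+ d) := (a :+ c) :+ (b :+ d)) refl

  ∑-*ˡ : ∀ (xs : List A) s f → ∑ xs (λ x → s * f x) ≡ s * ∑ xs f
  ∑-*ˡ [] s f = sym (ℚP.*-zeroʳ s)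
  ∑-*ˡ (x ∷ xs) s f = trans (cong (λ t → s * f x + t) (∑-*ˡ xs s f)) (sym (ℚP.*-distribˡ-+ s _ _))

  ∑-const : ∀ (xs : List A) c → ∑ xs (λ _ → c) ≡ ι (length xs) * c
  ∑-const [] c = sym (ℚP.*-zeroˡ c)
  ∑-const (x ∷ xs) c = begin
    c + ∑ xs (λ _ → c)
      ≡⟨ cong (λ t → c + t) (∑-const xs c) ⟩
    c + ι (length xs) * c
      ≡⟨ solve 2 (λ c n → c :+ n :* c := (con 1ℚ :+ n) :* c) refl c (ι (length xs)) ⟩
    (1ℚ + ι (length xs)) * c
      ≡⟨ cong (_* c) (sym (ι-+ 1 (length xs))) ⟩
    ι (suc (length xs)) * c ∎
    where open ≡-Reasoning

  ∑-zero : ∀ (xs : List A) → ∑ xs (λ _ → 0ℚ) ≡ 0ℚ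
  ∑-zero xs = trans (∑-const xs 0ℚ) (ℚP.*-zeroʳ (ι (length xs)))

  ∑-map : ∀ {B : Set} (h : A → B) xs (f : B → ℚ) → ∑ (map h xs) f ≡ ∑ xs (λ x → f (h x))
  ∑-map h xs f = cong sumℚ (sym (ListP.map-∘ xs))

  ∑-partition : ∀ {P : A → Set} (P? : Decidable P) xs f →
    ∑ xs f ≡ ∑ (filter (λ x → ¬? (P? x)) xs) f + ∑ (filter P? xs) f
  ∑-partition P? [] f = sym (ℚP.+-identityˡ 0ℚ)
  ∑-partition P? (x ∷ xs) f with P? x
  ... | yes _ = trans (cong (λ t → f x + t) (∑-partition P? xs f))
                      (solve 3 (λ a b c → a :+ (b :+ c) := b :+ (a :+ c)) refl (f x)
                        (∑ (filter (λ x → ¬? (P? x)) xs) f) (∑ (filter P? xs) f))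
  ... | no _ = trans (cong (λ t → f x + t) (∑-partition P? xs f)) (sym (ℚP.+-assoc (f x) _ _))

∑ℕ : {A : Set} → List A → (A → ℕ) → ℕ
∑ℕ xs f = sum (map f xs)

module _ {A : Set} where

  ι-∑ℕ : ∀ (xs : List A) f → ι (∑ℕ xs f) ≡ ∑ xs (λ x → ι (f x))
  ι-∑ℕ [] f = refl
  ι-∑ℕ (x ∷ xs) f = trans (ι-+ (f x) (∑ℕ xs f)) (cong (λ t → ι (f x) + t) (ι-∑ℕ xs f))

  ∑ℕ≡0⇒≡0 : ∀ (xs : List A) f → ∑ℕ xs f ≡ 0 → ∀ {x} → x ∈ xs → f x ≡ 0
  ∑ℕ≡0⇒≡0 (y ∷ xs) f eq (here refl) = ℕP.m+n≡0⇒m≡0 (f y) eq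
  ∑ℕ≡0⇒≡0 (y ∷ xs) f eq (there x∈) = ∑ℕ≡0⇒≡0 xs f (ℕP.m+n≡0⇒n≡0 (f y) eq) x∈

∑-upTo-suc : ∀ n f → ∑ (upTo (suc n)) f ≡ ∑ (upTo n) f + f n
∑-upTo-suc n f = begin
  ∑ (upTo (suc n)) f          ≡⟨ cong (λ xs → ∑ xs f) (sym (ListP.upTo-∷ʳ n)) ⟩
  ∑ (upTo n ++ [ n ]) f       ≡⟨ ∑-++ (upTo n) [ n ] f ⟩
  ∑ (upTo n) f + (f n + 0ℚ)   ≡⟨ cong (λ t → ∑ (upTo n) f + t) (ℚP.+-identityʳ (f n)) ⟩
  ∑ (upTo n) f + f n          ∎
  where open ≡-Reasoning

∑-upTo-cong : ∀ n {f g} → (∀ i → i < n → f i ≡ g i) → ∑ (upTo n) f ≡ ∑ (upTo n) g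
∑-upTo-cong n f≗g = ∑-cong-∈ (upTo n) (λ i∈ → f≗g _ (∈P.∈-upTo⁻ i∈))

∑-upTo-+ : ∀ a b f → ∑ (upTo (a ℕ.+ b)) f ≡ ∑ (upTo a) f + ∑ (upTo b) (λ i → f (a ℕ.+ i))
∑-upTo-+ a zero f = trans (cong (λ n → ∑ (upTo n) f) (ℕP.+-identityʳ a)) (sym (ℚP.+-identityʳ _))
∑-upTo-+ a (suc b) f = begin
  ∑ (upTo (a ℕ.+ suc b)) f                 ≡⟨ cong (λ n → ∑ (upTo n) f) (ℕP.+-suc a b) ⟩
  ∑ (upTo (suc (a ℕ.+ b))) f               ≡⟨ ∑-upTo-suc (a ℕ.+ b) f ⟩
  ∑ (upTo (a ℕ.+ b)) f + f (a ℕ.+ b)       ≡⟨ cong (_+ f (a ℕ.+ b)) (∑-upTo-+ a b f) ⟩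
  (Sa + Sb) + f (a ℕ.+ b)                  ≡⟨ ℚP.+-assoc Sa Sb _ ⟩
  Sa + (Sb + f (a ℕ.+ b))                  ≡⟨ cong (λ t → Sa + t) (sym (∑-upTo-suc b (λ i → f (a ℕ.+ i)))) ⟩
  Sa + ∑ (upTo (suc b)) (λ i → f (a ℕ.+ i)) ∎
  where
  open ≡-Reasoning
  Sa = ∑ (upTo a) f
  Sb = ∑ (upTo b) (λ i → f (a ℕ.+ i))

δₙ : ℕ → ℕ → ℚ
δₙ i r with i ℕ.≟ r
... | yes _ = 1ℚ
... | no _ = 0ℚ

δₙ-refl : ∀ i → δₙ i i ≡ 1ℚ
δₙ-refl i with i ℕ.≟ i
... | yes _ = refl
... | no i≢i = ⊥-elim (i≢i refl)

δₙ-≢ : ∀ {i r} → i ≢ r → δₙ i r ≡ 0ℚ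
δₙ-≢ {i} {r} i≢r with i ℕ.≟ r
... | yes i≡r = ⊥-elim (i≢r i≡r)
... | no _ = refl

∑-δₙ : ∀ n r (f : ℕ → ℚ) → r < n → ∑ (upTo n) (λ i → f i * δₙ i r) ≡ f r
∑-δₙ (suc n) r f r<1+n with r ℕ.≟ n
... | no r≢n = begin
  ∑ (upTo (suc n)) (λ i → f i * δₙ i r)
    ≡⟨ ∑-upTo-suc n (λ i → f i * δₙ i r) ⟩
  ∑ (upTo n) (λ i → f i * δₙ i r) + f n * δₙ n r
    ≡⟨ cong₂ _+_ (∑-δₙ n r f (ℕP.≤∧≢⇒< (ℕP.≤-pred r<1+n) r≢n)) (cong (f n *_) (δₙ-≢ (r≢n ∘ sym))) ⟩
  f r + f n * 0ℚ
    ≡⟨ solve 2 (λ a b → a :+ b :* con 0ℚ := a) refl (f r) (f n) ⟩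
  f r ∎
  where open ≡-Reasoning
... | yes refl = begin
  ∑ (upTo (suc r)) (λ i → f i * δₙ i r)
    ≡⟨ ∑-upTo-suc r (λ i → f i * δₙ i r) ⟩
  ∑ (upTo r) (λ i → f i * δₙ i r) + f r * δₙ r r
    ≡⟨ cong₂ _+_ (trans (∑-upTo-cong r (λ i i<r → cong (f i *_) (δₙ-≢ (ℕP.<⇒≢ i<r)))) (∑-*-zero (upTo r)))
                 (cong (f r *_) (δₙ-refl r)) ⟩
  0ℚ + f r * 1ℚ
    ≡⟨ solve 1 (λ a → con 0ℚ :+ a :* con 1ℚ := a) refl (f r) ⟩
  f r ∎
  where
  open ≡-Reasoning
  ∑-*-zero : ∀ xs → ∑ xs (λ i → f i * 0ℚ) ≡ 0ℚ
  ∑-*-zero xs = trans (∑-cong xs (λ i → ℚP.*-zeroʳ (f i))) (∑-zero xs)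

δ : ℕ → ℤ → ℚ
δ m z with m ∣? ℤ.∣ z ∣
... | yes _ = 1ℚ
... | no _ = 0ℚ

δ-∣ : ∀ {m z} → m ∣ ℤ.∣ z ∣ → δ m z ≡ 1ℚ
δ-∣ {m} {z} m∣z with m ∣? ℤ.∣ z ∣
... | yes _ = refl
... | no m∤z = ⊥-elim (m∤z m∣z)

δ-∤ : ∀ {m z} → ¬ m ∣ ℤ.∣ z ∣ → δ m z ≡ 0ℚ
δ-∤ {m} {z} m∤z with m ∣? ℤ.∣ z ∣
... | yes m∣z = ⊥-elim (m∤z m∣z)
... | no _ = refl

δ-cong-∣∣ : ∀ m {z z'} → ℤ.∣ z ∣ ≡ ℤ.∣ z' ∣ → δ m z ≡ δ m z'
δ-cong-∣∣ m {z} {z'} eq with m ∣? ℤ.∣ z ∣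
... | yes m∣z = sym (δ-∣ (subst (m ∣_) eq m∣z))
... | no m∤z = sym (δ-∤ (m∤z ∘ subst (m ∣_) (sym eq)))

δ-neg : ∀ m z → δ m (ℤ.- z) ≡ δ m z
δ-neg m z = δ-cong-∣∣ m (ℤP.∣-i∣≡∣i∣ z)

δ-cong-mod : ∀ m {z z'} → + m ℤS.∣ (z ℤ.- z') → δ m z ≡ δ m z'
δ-cong-mod m {z} {z'} m∣z-z' with m ∣? ℤ.∣ z ∣
... | yes m∣z = sym (δ-∣ (ℤS.∣⇒∣ᵤ (subst (+ m ℤS.∣_) (z-[z-z']≡z' z z')
                    (ℤS.∣m∣n⇒∣m-n (ℤS.∣ᵤ⇒∣ {+ m} {z} m∣z) m∣z-z'))))
  where
  z-[z-z']≡z' : ∀ z z' → z ℤ.- (z ℤ.- z') ≡ z'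
  z-[z-z']≡z' = solve-∀
... | no m∤z = sym (δ-∤ (λ m∣z' → m∤z (ℤS.∣⇒∣ᵤ (subst (+ m ℤS.∣_) (z-z'+z'≡z z z')
                    (ℤS.∣m∣n⇒∣m+n m∣z-z' (ℤS.∣ᵤ⇒∣ {+ m} {z'} m∣z'))))))
  where
  z-z'+z'≡z : ∀ z z' → (z ℤ.- z') ℤ.+ z' ≡ z
  z-z'+z'≡z = solve-∀

δ-*-cancelʳ : ∀ a b .{{_ : NonZero b}} z → δ (a ℕ.* b) (z ℤ.* + b) ≡ δ a z
δ-*-cancelʳ a b z with a ∣? ℤ.∣ z ∣
... | yes a∣z = δ-∣ (subst (a ℕ.* b ∣_) (sym (ℤP.abs-* z (+ b))) (ℕD.*-monoˡ-∣ b a∣z))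
... | no a∤z = δ-∤ (a∤z ∘ ℕD.*-cancelʳ-∣ b ∘ subst (a ℕ.* b ∣_) (ℤP.abs-* z (+ b)))

∣∧<⇒≡0 : ∀ {m n} → m ∣ n → n < m → n ≡ 0
∣∧<⇒≡0 {suc m} {n} m∣n n<m = trans (sym (DM.m<n⇒m%n≡m n<m)) (ℕD.n∣m⇒m%n≡0 n (suc m) m∣n)
  where import Data.Nat.DivMod as DM

private
  ≡-mod-≤ : ∀ {m i r} → i < m → r ≤ i → m ∣ ℤ.∣ + i ℤ.- + r ∣ → i ≡ r
  ≡-mod-≤ {m} {i} {r} i<m r≤i m∣i-r = ℕP.≤-antisym (ℕP.m∸n≡0⇒m≤n i∸r≡0) r≤i
    where
    ∣i-r∣≡i∸r : ℤ.∣ + i ℤ.- + r ∣ ≡ i ∸ r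
    ∣i-r∣≡i∸r = cong ℤ.∣_∣ (trans (ℤP.m-n≡m⊖n i r) (ℤP.⊖-≥ r≤i))
    i∸r≡0 : i ∸ r ≡ 0
    i∸r≡0 = ∣∧<⇒≡0 (subst (m ∣_) ∣i-r∣≡i∸r m∣i-r) (ℕP.≤-<-trans (ℕP.m∸n≤m i r) i<m)

≡-mod-< : ∀ {m i r} → i < m → r < m → m ∣ ℤ.∣ + i ℤ.- + r ∣ → i ≡ r
≡-mod-< {m} {i} {r} i<m r<m m∣ with ℕP.≤-total r i
... | inj₁ r≤i = ≡-mod-≤ i<m r≤i m∣
... | inj₂ i≤r = sym (≡-mod-≤ r<m i≤r (subst (m ∣_) (ℤP.∣i-j∣≡∣j-i∣ (+ i) (+ r)) m∣))

δ-sub-< : ∀ {m i r} → i < m → r < m → δ m (+ i ℤ.- + r) ≡ δₙ i r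
δ-sub-< {m} {i} {r} i<m r<m with i ℕ.≟ r
... | yes refl = δ-∣ (subst (m ∣_) (sym (cong ℤ.∣_∣ (ℤP.+-inverseʳ (+ i)))) (m ℕD.∣0))
... | no i≢r = δ-∤ (i≢r ∘ ≡-mod-< i<m r<m)

∑-δ : ∀ m .{{_ : NonZero m}} y (f : ℕ → ℚ) → ∑ (upTo m) (λ i → f i * δ m (+ i ℤ.- y)) ≡ f (y ℤ.%ℕ m)
∑-δ m y f = trans (∑-upTo-cong m (λ i i<m → cong (f i *_) (trans (δ-cong-mod m (y≡r i)) (δ-sub-< i<m r<m))))
                  (∑-δₙ m r f r<m)
  where
  r = y ℤ.%ℕ m
  r<m : r < m
  r<m = ℤDM.n%ℕd<d y m
  shift : ∀ i r q m → (i ℤ.- (r ℤ.+ q ℤ.* m)) ℤ.- (i ℤ.- r) ≡ (ℤ.- q) ℤ.* m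
  shift = solve-∀
  y≡r : ∀ i → + m ℤS.∣ ((+ i ℤ.- y) ℤ.- (+ i ℤ.- + r))
  y≡r i = ℤS.divides (ℤ.- (y ℤ./ℕ m))
    (trans (cong (λ y → (+ i ℤ.- y) ℤ.- (+ i ℤ.- + r)) (ℤDM.a≡a%ℕn+[a/ℕn]*n y m)) (shift (+ i) (+ r) (y ℤ./ℕ m) (+ m)))

∑-δ-lifts : ∀ ℓ P .{{_ : NonZero ℓ}} .{{_ : NonZero P}} y →
  ∑ (upTo ℓ) (λ t → δ (ℓ ℕ.* P) (+ (t ℕ.* P) ℤ.- y)) ≡ δ P y
∑-δ-lifts ℓ P y with P ∣? ℤ.∣ y ∣
... | yes P∣y = begin
  ∑ (upTo ℓ) (λ t → δ (ℓ ℕ.* P) (+ (t ℕ.* P) ℤ.- y))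
    ≡⟨ ∑-cong (upTo ℓ) (λ t → trans (cong (δ (ℓ ℕ.* P)) (lift t)) (δ-*-cancelʳ ℓ P (+ t ℤ.- y'))) ⟩
  ∑ (upTo ℓ) (λ t → δ ℓ (+ t ℤ.- y'))
    ≡⟨ ∑-cong (upTo ℓ) (λ t → sym (ℚP.*-identityˡ _)) ⟩
  ∑ (upTo ℓ) (λ t → 1ℚ * δ ℓ (+ t ℤ.- y'))
    ≡⟨ ∑-δ ℓ y' (λ _ → 1ℚ) ⟩
  1ℚ ∎
  where
  open ≡-Reasoning
  y' = ℤS._∣_.quotient (ℤS.∣ᵤ⇒∣ {+ P} {y} P∣y)
  tP-yP : ∀ t y' P → t ℤ.* P ℤ.- y' ℤ.* P ≡ (t ℤ.- y') ℤ.* P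
  tP-yP = solve-∀
  lift : ∀ t → + (t ℕ.* P) ℤ.- y ≡ (+ t ℤ.- y') ℤ.* + P
  lift t = trans (cong₂ ℤ._-_ (ℤP.pos-* t P) (ℤS._∣_.equality (ℤS.∣ᵤ⇒∣ {+ P} {y} P∣y))) (tP-yP (+ t) y' (+ P))
... | no P∤y = trans (∑-cong (upTo ℓ) (λ t → δ-∤ (P∤y ∘ P∣y t))) (∑-zero (upTo ℓ))
  where
  tP-[tP-y]≡y : ∀ a y → a ℤ.- (a ℤ.- y) ≡ y
  tP-[tP-y]≡y = solve-∀
  P∣y : ∀ t → ℓ ℕ.* P ∣ ℤ.∣ + (t ℕ.* P) ℤ.- y ∣ → P ∣ ℤ.∣ y ∣
  P∣y t ℓP∣ = ℤS.∣⇒∣ᵤ (subst (+ P ℤS.∣_) (tP-[tP-y]≡y (+ (t ℕ.* P)) y)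
    (ℤS.∣m∣n⇒∣m-n (ℤS.∣ᵤ⇒∣ {+ P} {+ (t ℕ.* P)} (ℕD.n∣m*n t))
                  (ℤS.∣ᵤ⇒∣ {+ P} {+ (t ℕ.* P) ℤ.- y} (ℕD.∣-trans (ℕD.n∣m*n ℓ) ℓP∣))))

-- Formal sums Σ c·ζ^a

⟪_⟫ : Cyc → (ℤ → ℚ) → ℚ
⟪ [] ⟫ g = 0ℚ
⟪ (c , a) ∷ x ⟫ g = c * g a + ⟪ x ⟫ g

⟪⟫-cong : ∀ x {g h} → (∀ a → g a ≡ h a) → ⟪ x ⟫ g ≡ ⟪ x ⟫ h
⟪⟫-cong [] _ = refl
⟪⟫-cong ((c , a) ∷ x) g≗h = cong₂ _+_ (cong (c *_) (g≗h a)) (⟪⟫-cong x g≗h)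

⟪⟫-++ : ∀ x y g → ⟪ x ⊕ y ⟫ g ≡ ⟪ x ⟫ g + ⟪ y ⟫ g
⟪⟫-++ [] y g = sym (ℚP.+-identityˡ _)
⟪⟫-++ ((c , a) ∷ x) y g = trans (cong (λ t → c * g a + t) (⟪⟫-++ x y g)) (sym (ℚP.+-assoc (c * g a) _ _))

⟪⟫-+ : ∀ x g h → ⟪ x ⟫ (λ a → g a + h a) ≡ ⟪ x ⟫ g + ⟪ x ⟫ h
⟪⟫-+ [] g h = sym (ℚP.+-identityˡ _)
⟪⟫-+ ((c , a) ∷ x) g h = trans (cong (λ t → c * (g a + h a) + t) (⟪⟫-+ x g h))
  (solve 5 (λ c g h v w → c :* (g :+ h) :+ (v :+ w) := (c :* g :+ v) :+ (c :* h :+ w)) refl c (g a) (h a) (⟪ x ⟫ g) (⟪ x ⟫ h))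

⟪⟫-*ˡ : ∀ x s g → ⟪ x ⟫ (λ a → s * g a) ≡ s * ⟪ x ⟫ g
⟪⟫-*ˡ [] s g = sym (ℚP.*-zeroʳ s)
⟪⟫-*ˡ ((c , a) ∷ x) s g = trans (cong (λ t → c * (s * g a) + t) (⟪⟫-*ˡ x s g))
  (solve 4 (λ c s g v → c :* (s :* g) :+ s :* v := s :* (c :* g :+ v)) refl c s (g a) (⟪ x ⟫ g))

⟪⟫-Σ : ∀ {A : Set} (xs : List A) (f : A → Cyc) g → ⟪ Σ[ xs ] f ⟫ g ≡ ∑ xs (λ i → ⟪ f i ⟫ g)
⟪⟫-Σ [] f g = refl
⟪⟫-Σ (x ∷ xs) f g = trans (⟪⟫-++ (f x) (Σ[ xs ] f) g) (cong (λ t → ⟪ f x ⟫ g + t) (⟪⟫-Σ xs f g))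

⟪⟫-ζ^ : ∀ a g → ⟪ ζ^ a ⟫ g ≡ g a
⟪⟫-ζ^ a g = trans (ℚP.+-identityʳ _) (ℚP.*-identityˡ _)

⟪⟫-const : ∀ q g → ⟪ const q ⟫ g ≡ q * g (+ 0)
⟪⟫-const q g = ℚP.+-identityʳ _

⟪⟫-scale : ∀ d x g → ⟪ scale d x ⟫ g ≡ d * ⟪ x ⟫ g
⟪⟫-scale d [] g = sym (ℚP.*-zeroʳ d)
⟪⟫-scale d ((c , a) ∷ x) g = trans (cong₂ _+_ (ℚP.*-assoc d c (g a)) (⟪⟫-scale d x g)) (sym (ℚP.*-distribˡ-+ d _ _))

⟪⟫-neg : ∀ x g → ⟪ neg x ⟫ g ≡ - ⟪ x ⟫ g
⟪⟫-neg x g = trans (⟪⟫-scale (- 1ℚ) x g) (solve 1 (λ v → :- con 1ℚ :* v := :- v) refl (⟪ x ⟫ g))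

⟪⟫-conj : ∀ x g → ⟪ conj x ⟫ g ≡ ⟪ x ⟫ (λ a → g (ℤ.- a))
⟪⟫-conj [] g = refl
⟪⟫-conj ((c , a) ∷ x) g = cong (λ t → c * g (ℤ.- a) + t) (⟪⟫-conj x g)

⟪⟫-⊗ : ∀ x y g → ⟪ x ⊗ y ⟫ g ≡ ⟪ x ⟫ (λ a → ⟪ y ⟫ (λ b → g (a ℤ.+ b)))
⟪⟫-⊗ [] y g = refl
⟪⟫-⊗ ((c , a) ∷ x) y g = trans (split _ y (x ⊗ y)) (cong₂ _+_ (single⊗ y) (⟪⟫-⊗ x y g))
  where
  split : ∀ F y z → ⟪ map F y ++ z ⟫ g ≡ ⟪ map F y ++ [] ⟫ g + ⟪ z ⟫ g
  split F y z = trans (⟪⟫-++ (map F y) z g) (cong (λ w → ⟪ w ⟫ g + ⟪ z ⟫ g) (sym (ListP.++-identityʳ (map F y))))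
  single⊗ : ∀ y → ⟪ [ (c , a) ] ⊗ y ⟫ g ≡ c * ⟪ y ⟫ (λ b → g (a ℤ.+ b))
  single⊗ [] = sym (ℚP.*-zeroʳ c)
  single⊗ ((d , b) ∷ y) = trans (cong₂ _+_ (ℚP.*-assoc c d _) (single⊗ y)) (sym (ℚP.*-distribˡ-+ c _ _))

⟪⟫-map : ∀ {A : Set} (xs : List A) (c : A → ℚ) (a : A → ℤ) g →
  ⟪ map (λ t → (c t , a t)) xs ⟫ g ≡ ∑ xs (λ t → c t * g (a t))
⟪⟫-map [] c a g = refl
⟪⟫-map (x ∷ xs) c a g = cong (λ t → c x * g (a x) + t) (⟪⟫-map xs c a g)

∑-⟪⟫ : ∀ {A : Set} (xs : List A) z (g : ℤ → A → ℚ) →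
  ∑ xs (λ t → ⟪ z ⟫ (λ a → g a t)) ≡ ⟪ z ⟫ (λ a → ∑ xs (g a))
∑-⟪⟫ xs [] g = ∑-zero xs
∑-⟪⟫ xs ((c , a) ∷ z) g = trans (∑-+ xs _ _) (cong₂ _+_ (∑-*ˡ xs c (g a)) (∑-⟪⟫ xs z g))

coeffℤ : ℕ → Cyc → ℤ → ℚ
coeffℤ L x j = ⟪ x ⟫ (λ a → δ L (a ℤ.- j))

coeff≡coeffℤ : ∀ L x j → coeff L x j ≡ coeffℤ L x (+ j)
coeff≡coeffℤ L [] j = refl
coeff≡coeffℤ L ((c , a) ∷ x) j with L ∣? ℤ.∣ a ℤ.- + j ∣
... | yes _ = cong₂ _+_ (sym (ℚP.*-identityʳ c)) (coeff≡coeffℤ L x j)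
... | no _ = trans (coeff≡coeffℤ L x j) (sym (trans (cong (_+ coeffℤ L x (+ j)) (ℚP.*-zeroʳ c)) (ℚP.+-identityˡ _)))

coeffℤ-+L : ∀ L x z → coeffℤ L x (z ℤ.+ + L) ≡ coeffℤ L x z
coeffℤ-+L L x z = ⟪⟫-cong x (λ a → δ-cong-mod L (ℤS.divides (ℤ.- + 1) (shift a z (+ L))))
  where
  shift : ∀ a z l → (a ℤ.- (z ℤ.+ l)) ℤ.- (a ℤ.- z) ≡ (ℤ.- + 1) ℤ.* l
  shift = solve-∀

periodic-* : ∀ (f : ℤ → ℚ) s → (∀ z → f (z ℤ.+ s) ≡ f z) → ∀ q z → f (z ℤ.+ q ℤ.* s) ≡ f z
periodic-* f s per (+ k) z = periodic-ℕ k z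
  where
  step : ∀ z k s → z ℤ.+ (+ 1 ℤ.+ k) ℤ.* s ≡ (z ℤ.+ k ℤ.* s) ℤ.+ s
  step = solve-∀
  periodic-ℕ : ∀ k z → f (z ℤ.+ + k ℤ.* s) ≡ f z
  periodic-ℕ zero z = cong f (trans (cong (λ t → z ℤ.+ t) (ℤP.*-zeroˡ s)) (ℤP.+-identityʳ z))
  periodic-ℕ (suc k) z = trans (cong f (step z (+ k) s)) (trans (per _) (periodic-ℕ k z))
periodic-* f s per -[1+ k ] z =
  trans (sym (periodic-* f s per (+ suc k) (z ℤ.+ -[1+ k ] ℤ.* s))) (cong f (back z (+ suc k) s))
  where
  back : ∀ z n s → (z ℤ.+ (ℤ.- n) ℤ.* s) ℤ.+ n ℤ.* s ≡ z
  back = solve-∀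

-- x ≡ s·ζ^c in ℚ[ζ]/(ζ^L - 1)

record Monomial (L : ℕ) (x : Cyc) (s : ℚ) (c : ℤ) : Set where
  constructor monomial
  field coeffℤ-≐ : ∀ j → coeffℤ L x j ≡ s * δ L (c ℤ.- j)
open Monomial

Monomial-resp : ∀ {L x s c c'} → + L ℤS.∣ (c ℤ.- c') → Monomial L x s c → Monomial L x s c'
Monomial-resp {L} {s = s} {c} {c'} (ℤS.divides q eq) (monomial x≐) =
  monomial λ j → trans (x≐ j) (cong (s *_) (δ-cong-mod L (ℤS.divides q (trans (shift c c' j) eq))))
  where
  shift : ∀ c c' j → (c ℤ.- j) ℤ.- (c' ℤ.- j) ≡ c ℤ.- c'
  shift = solve-∀

Monomial-≡ : ∀ {L x s s' c c'} → s ≡ s' → c ≡ c' → Monomial L x s c → Monomial L x s' c'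
Monomial-≡ refl refl x≐ = x≐

Monomial-ζ^ : ∀ L a → Monomial L (ζ^ a) 1ℚ a
Monomial-ζ^ L a = monomial λ j → trans (⟪⟫-ζ^ a (λ b → δ L (b ℤ.- j))) (sym (ℚP.*-identityˡ (δ L (a ℤ.- j))))

Monomial-const : ∀ L q → Monomial L (const q) q (+ 0)
Monomial-const L q = monomial λ j → ⟪⟫-const q (λ b → δ L (b ℤ.- j))

Monomial-scale : ∀ {L x s c} d → Monomial L x s c → Monomial L (scale d x) (d * s) c
Monomial-scale {x = x} {s} d (monomial x≐) =
  monomial λ j → trans (⟪⟫-scale d x _) (trans (cong (d *_) (x≐ j)) (sym (ℚP.*-assoc d s _)))

Monomial-⊗ : ∀ {L x y s t c d} → Monomial L x s c → Monomial L y t d → Monomial L (x ⊗ y) (s * t) (c ℤ.+ d)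
Monomial-⊗ {L} {x} {y} {s} {t} {c} {d} (monomial x≐) (monomial y≐) = monomial λ j → begin
  ⟪ x ⊗ y ⟫ (λ a → δ L (a ℤ.- j))
    ≡⟨ ⟪⟫-⊗ x y _ ⟩
  ⟪ x ⟫ (λ a → ⟪ y ⟫ (λ b → δ L ((a ℤ.+ b) ℤ.- j)))
    ≡⟨ ⟪⟫-cong x (λ a → ⟪⟫-cong y (λ b → cong (δ L) (e₁ a b j))) ⟩
  ⟪ x ⟫ (λ a → coeffℤ L y (j ℤ.- a))
    ≡⟨ ⟪⟫-cong x (λ a → trans (y≐ (j ℤ.- a)) (cong (t *_) (cong (δ L) (e₂ d j a)))) ⟩
  ⟪ x ⟫ (λ a → t * δ L (a ℤ.- (j ℤ.- d)))
    ≡⟨ ⟪⟫-*ˡ x t _ ⟩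
  t * coeffℤ L x (j ℤ.- d)
    ≡⟨ cong (t *_) (x≐ (j ℤ.- d)) ⟩
  t * (s * δ L (c ℤ.- (j ℤ.- d)))
    ≡⟨ solve 3 (λ t s u → t :* (s :* u) := (s :* t) :* u) refl t s _ ⟩
  (s * t) * δ L (c ℤ.- (j ℤ.- d))
    ≡⟨ cong ((s * t) *_) (cong (δ L) (e₃ c d j)) ⟩
  (s * t) * δ L ((c ℤ.+ d) ℤ.- j) ∎
  where
  open ≡-Reasoning
  e₁ : ∀ a b j → (a ℤ.+ b) ℤ.- j ≡ b ℤ.- (j ℤ.- a)
  e₁ = solve-∀
  e₂ : ∀ d j a → d ℤ.- (j ℤ.- a) ≡ a ℤ.- (j ℤ.- d)
  e₂ = solve-∀
  e₃ : ∀ c d j → c ℤ.- (j ℤ.- d) ≡ (c ℤ.+ d) ℤ.- j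
  e₃ = solve-∀

Monomial-pow : ∀ {L x c} → Monomial L x 1ℚ c → ∀ n → Monomial L (pow x n) 1ℚ (+ n ℤ.* c)
Monomial-pow {L} {c = c} _ zero = Monomial-≡ refl (sym (ℤP.*-zeroˡ c)) (Monomial-const L 1ℚ)
Monomial-pow {c = c} x≐ (suc n) =
  Monomial-≡ (ℚP.*-identityˡ 1ℚ) (c+nc c (+ n)) (Monomial-⊗ x≐ (Monomial-pow x≐ n))
  where
  c+nc : ∀ c n → c ℤ.+ n ℤ.* c ≡ (+ 1 ℤ.+ n) ℤ.* c
  c+nc = solve-∀

Monomial-conj : ∀ {L x s c} → Monomial L x s c → Monomial L (conj x) s (ℤ.- c)
Monomial-conj {L} {x} {s} {c} (monomial x≐) = monomial λ j → begin
  ⟪ conj x ⟫ (λ a → δ L (a ℤ.- j))      ≡⟨ ⟪⟫-conj x _ ⟩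
  ⟪ x ⟫ (λ a → δ L (ℤ.- a ℤ.- j))       ≡⟨ ⟪⟫-cong x (λ a → trans (cong (δ L) (e a j)) (δ-neg L _)) ⟩
  coeffℤ L x (ℤ.- j)                    ≡⟨ x≐ (ℤ.- j) ⟩
  s * δ L (c ℤ.- ℤ.- j)                 ≡⟨ cong (s *_) (trans (sym (δ-neg L _)) (cong (δ L) (e' c j))) ⟩
  s * δ L (ℤ.- c ℤ.- j)                 ∎
  where
  open ≡-Reasoning
  e : ∀ a j → ℤ.- a ℤ.- j ≡ ℤ.- (a ℤ.- ℤ.- j)
  e = solve-∀
  e' : ∀ c j → ℤ.- (c ℤ.- ℤ.- j) ≡ ℤ.- c ℤ.- j
  e' = solve-∀

Monomial-Σ : ∀ {A : Set} {L c} (xs : List A) (f : A → Cyc) (s : A → ℚ) →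
  (∀ {i} → i ∈ xs → Monomial L (f i) (s i) c) → Monomial L (Σ[ xs ] f) (∑ xs s) c
Monomial-Σ {L = L} {c} xs f s f≐ = monomial λ j → trans (⟪⟫-Σ xs f _) (go xs f≐ j)
  where
  go : ∀ xs → (∀ {i} → i ∈ xs → Monomial L (f i) (s i) c) → ∀ j →
       ∑ xs (λ i → coeffℤ L (f i) j) ≡ ∑ xs s * δ L (c ℤ.- j)
  go [] _ j = sym (ℚP.*-zeroˡ (δ L (c ℤ.- j)))
  go (x ∷ xs) f≐ j = trans (cong₂ _+_ (coeffℤ-≐ (f≐ (here refl)) j) (go xs (λ i∈ → f≐ (there i∈)) j))
                           (sym (ℚP.*-distribʳ-+ _ (s x) (∑ xs s)))

Σζ^ : {A : Set} → List A → (A → ℤ) → Cyc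
Σζ^ xs a = Σ[ xs ] (λ v → ζ^ (a v))

Monomial-Σζ^ : ∀ {A : Set} L (xs : List A) (a : A → ℤ) c →
  (∀ {v} → v ∈ xs → + L ℤS.∣ (a v ℤ.- c)) → Monomial L (Σζ^ xs a) (ι (length xs)) c
Monomial-Σζ^ L xs a c a≡c =
  Monomial-≡ (trans (∑-const xs 1ℚ) (ℚP.*-identityʳ _)) refl
    (Monomial-Σ xs (λ v → ζ^ (a v)) (λ _ → 1ℚ) (λ v∈ → Monomial-resp (a≡c v∈) (Monomial-ζ^ L _)))

periodic⇒coeffℤ : ∀ L P .{{_ : NonZero P}} g → (∀ j → coeffℤ L g (j ℤ.+ + P) ≡ coeffℤ L g j) →
  ∃ λ h → ∀ j → coeffℤ L g j ≡ coeffℤ P h j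
periodic⇒coeffℤ L P g per = h , λ j → sym (begin
  coeffℤ P h j
    ≡⟨ ⟪⟫-map (upTo P) (λ i → coeffℤ L g (+ i)) +_ (λ a → δ P (a ℤ.- j)) ⟩
  ∑ (upTo P) (λ i → coeffℤ L g (+ i) * δ P (+ i ℤ.- j))
    ≡⟨ ∑-δ P j (λ i → coeffℤ L g (+ i)) ⟩
  coeffℤ L g (+ (j ℤ.%ℕ P))
    ≡⟨ periodic-* (coeffℤ L g) (+ P) per (j ℤ./ℕ P) (+ (j ℤ.%ℕ P)) ⟨
  coeffℤ L g (+ (j ℤ.%ℕ P) ℤ.+ (j ℤ./ℕ P) ℤ.* + P)
    ≡⟨ cong (coeffℤ L g) (ℤDM.a≡a%ℕn+[a/ℕn]*n j P) ⟨
  coeffℤ L g j ∎)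
  where
  open ≡-Reasoning
  h = map (λ i → (coeffℤ L g (+ i) , + i)) (upTo P)

-- Equality in ℚ(ζ_L), L = ℓ^(1+e'), P = ℓ^e'

module Cyclotomic (ℓ e' : ℕ) .{{_ : NonZero ℓ}} where

  P L : ℕ
  P = ℓ ^ e'
  L = ℓ ^ suc e'

  instance
    P≢0 : NonZero P
    P≢0 = ℕP.m^n≢0 ℓ e'

  -- Φ_L = Σ_{t<ℓ} ζ^(tP), so the multiples of Φ_L are the formal sums with P-periodic coefficients mod L.
  coeffℤ-⊗Φ : ∀ h j → coeffℤ L (h ⊗ Φ ℓ (suc e')) j ≡ coeffℤ P h j
  coeffℤ-⊗Φ h j = begin
    ⟪ h ⊗ Φ ℓ (suc e') ⟫ (λ a → δ L (a ℤ.- j))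
      ≡⟨ ⟪⟫-⊗ h (Φ ℓ (suc e')) (λ a → δ L (a ℤ.- j)) ⟩
    ⟪ h ⟫ (λ a → ⟪ Φ ℓ (suc e') ⟫ (λ b → δ L ((a ℤ.+ b) ℤ.- j)))
      ≡⟨ ⟪⟫-cong h (λ a → ⟪⟫-map (upTo ℓ) (λ _ → 1ℚ) (λ t → + (t ℕ.* P)) (λ b → δ L ((a ℤ.+ b) ℤ.- j))) ⟩
    ⟪ h ⟫ (λ a → ∑ (upTo ℓ) (λ t → 1ℚ * δ L ((a ℤ.+ + (t ℕ.* P)) ℤ.- j)))
      ≡⟨ ⟪⟫-cong h (λ a → ∑-cong (upTo ℓ) (λ t → trans (ℚP.*-identityˡ _) (cong (δ L) (reorder a (+ (t ℕ.* P)) j)))) ⟩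
    ⟪ h ⟫ (λ a → ∑ (upTo ℓ) (λ t → δ (ℓ ℕ.* P) (+ (t ℕ.* P) ℤ.- (j ℤ.- a))))
      ≡⟨ ⟪⟫-cong h (λ a → ∑-δ-lifts ℓ P (j ℤ.- a)) ⟩
    ⟪ h ⟫ (λ a → δ P (j ℤ.- a))
      ≡⟨ ⟪⟫-cong h (λ a → trans (sym (δ-neg P (j ℤ.- a))) (cong (δ P) (negate a j))) ⟩
    ⟪ h ⟫ (λ a → δ P (a ℤ.- j)) ∎
    where
    open ≡-Reasoning
    reorder : ∀ a b j → (a ℤ.+ b) ℤ.- j ≡ b ℤ.- (j ℤ.- a)
    reorder = solve-∀
    negate : ∀ a j → ℤ.- (j ℤ.- a) ≡ a ℤ.- j
    negate = solve-∀

  Eq-intro : ∀ x y h → (∀ j → coeffℤ L x j ≡ coeffℤ L y j + coeffℤ P h j) → Eq ℓ (suc e') x y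
  Eq-intro x y h x≡y+h = h , λ j _ → begin
    coeff L (x ⊕ neg y) j
      ≡⟨ coeff≡coeffℤ L (x ⊕ neg y) j ⟩
    coeffℤ L (x ⊕ neg y) (+ j)
      ≡⟨ ⟪⟫-++ x (neg y) _ ⟩
    coeffℤ L x (+ j) + coeffℤ L (neg y) (+ j)
      ≡⟨ cong₂ _+_ (x≡y+h (+ j)) (⟪⟫-neg y _) ⟩
    (coeffℤ L y (+ j) + coeffℤ P h (+ j)) - coeffℤ L y (+ j)
      ≡⟨ solve 2 (λ u v → (u :+ v) :+ (:- u) := v) refl (coeffℤ L y (+ j)) (coeffℤ P h (+ j)) ⟩
    coeffℤ P h (+ j)
      ≡⟨ coeffℤ-⊗Φ h (+ j) ⟨
    coeffℤ L (h ⊗ Φ ℓ (suc e')) (+ j)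
      ≡⟨ coeff≡coeffℤ L (h ⊗ Φ ℓ (suc e')) j ⟨
    coeff L (h ⊗ Φ ℓ (suc e')) j ∎
    where open ≡-Reasoning

  Eq-elim : ∀ {x y} ((h , _) : Eq ℓ (suc e') x y) →
    ∀ j → j < L → coeffℤ L x (+ j) ≡ coeffℤ L y (+ j) + coeffℤ P h (+ j)
  Eq-elim {x} {y} (h , x-y≡hΦ) j j<L = begin
    cx                                  ≡⟨ solve 2 (λ u v → u := v :+ (u :+ (:- v))) refl cx cy ⟩
    cy + (cx - cy)                      ≡⟨ cong (λ t → cy + t) (begin
      cx - cy                           ≡⟨ cong (λ t → cx + t) (⟪⟫-neg y _) ⟨
      cx + coeffℤ L (neg y) (+ j)        ≡⟨ ⟪⟫-++ x (neg y) _ ⟨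
      coeffℤ L (x ⊕ neg y) (+ j)         ≡⟨ coeff≡coeffℤ L (x ⊕ neg y) j ⟨
      coeff L (x ⊕ neg y) j              ≡⟨ x-y≡hΦ j j<L ⟩
      coeff L (h ⊗ Φ ℓ (suc e')) j       ≡⟨ coeff≡coeffℤ L (h ⊗ Φ ℓ (suc e')) j ⟩
      coeffℤ L (h ⊗ Φ ℓ (suc e')) (+ j)  ≡⟨ coeffℤ-⊗Φ h (+ j) ⟩
      coeffℤ P h (+ j)                   ∎) ⟩
    cy + coeffℤ P h (+ j)               ∎
    where
    open ≡-Reasoning
    cx = coeffℤ L x (+ j)
    cy = coeffℤ L y (+ j)

  -- x ↦ ⟪ x ⟫ τ kills every multiple of Φ_L, so it is a well-defined linear form on ℚ(ζ_L).
  τ : ℤ → ℚ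
  τ a = ι ℓ * δ L a - δ P a

  ⟪⟫τ : ∀ z → ⟪ z ⟫ τ ≡ ι ℓ * coeffℤ L z (+ 0) - ∑ (upTo ℓ) (λ t → coeffℤ L z (+ (t ℕ.* P)))
  ⟪⟫τ z = begin
    ⟪ z ⟫ τ
      ≡⟨ ⟪⟫-+ z (λ a → ι ℓ * δ L a) (λ a → - δ P a) ⟩
    ⟪ z ⟫ (λ a → ι ℓ * δ L a) + ⟪ z ⟫ (λ a → - δ P a)
      ≡⟨ cong₂ _+_ (⟪⟫-*ˡ z (ι ℓ) (δ L)) (trans (⟪⟫-cong z (λ a → -‿as-* (δ P a)))
                                          (trans (⟪⟫-*ˡ z (- 1ℚ) (δ P)) (sym (-‿as-* _)))) ⟩
    ι ℓ * ⟪ z ⟫ (δ L) - ⟪ z ⟫ (δ P)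
      ≡⟨ cong₂ (λ u v → ι ℓ * u - v) (⟪⟫-cong z (λ a → cong (δ L) (sym (ℤP.+-identityʳ a)))) (sym lifts) ⟩
    ι ℓ * coeffℤ L z (+ 0) - ∑ (upTo ℓ) (λ t → coeffℤ L z (+ (t ℕ.* P))) ∎
    where
    open ≡-Reasoning
    -‿as-* : ∀ q → - q ≡ - 1ℚ * q
    -‿as-* = solve 1 (λ q → :- q := :- con 1ℚ :* q) refl
    lifts : ∑ (upTo ℓ) (λ t → coeffℤ L z (+ (t ℕ.* P))) ≡ ⟪ z ⟫ (δ P)
    lifts = trans (∑-⟪⟫ (upTo ℓ) z (λ a t → δ L (a ℤ.- + (t ℕ.* P))))
      (⟪⟫-cong z (λ a → trans (∑-cong (upTo ℓ) (λ t → δ-cong-∣∣ L (ℤP.∣i-j∣≡∣j-i∣ a (+ (t ℕ.* P)))))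
                               (∑-δ-lifts ℓ P a)))

  ⟪⟫τ-resp-Eq : ∀ {x y} → Eq ℓ (suc e') x y → ⟪ x ⟫ τ ≡ ⟪ y ⟫ τ
  ⟪⟫τ-resp-Eq {x} {y} x≈y@(h , _) = begin
    ⟪ x ⟫ τ
      ≡⟨ ⟪⟫τ x ⟩
    ι ℓ * coeffℤ L x (+ 0) - ∑ (upTo ℓ) (λ t → coeffℤ L x (+ (t ℕ.* P)))
      ≡⟨ cong₂ (λ u v → ι ℓ * u - v) (Eq-elim {x} {y} x≈y 0 (ℕP.m^n>0 ℓ (suc e')))
           (∑-upTo-cong ℓ (λ t t<ℓ → trans (Eq-elim {x} {y} x≈y (t ℕ.* P) (ℕP.*-monoˡ-< P t<ℓ))
                                           (cong (λ c → cy (t ℕ.* P) + c) (ch-periodic t)))) ⟩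
    ι ℓ * (cy 0 + ch 0) - ∑ (upTo ℓ) (λ t → cy (t ℕ.* P) + ch 0)
      ≡⟨ cong (λ s → ι ℓ * (cy 0 + ch 0) - s)
           (trans (∑-+ (upTo ℓ) _ _) (cong (λ c → ∑ (upTo ℓ) (λ t → cy (t ℕ.* P)) + c)
             (trans (∑-const (upTo ℓ) (ch 0)) (cong (λ n → ι n * ch 0) (ListP.length-upTo ℓ))))) ⟩
    ι ℓ * (cy 0 + ch 0) - (∑ (upTo ℓ) (λ t → cy (t ℕ.* P)) + ι ℓ * ch 0)
      ≡⟨ solve 4 (λ l u v s → l :* (u :+ v) :+ (:- (s :+ l :* v)) := l :* u :+ (:- s)) refl
           (ι ℓ) (cy 0) (ch 0) (∑ (upTo ℓ) (λ t → cy (t ℕ.* P))) ⟩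
    ι ℓ * cy 0 - ∑ (upTo ℓ) (λ t → cy (t ℕ.* P))
      ≡⟨ ⟪⟫τ y ⟨
    ⟪ y ⟫ τ ∎
    where
    open ≡-Reasoning
    cy ch : ℕ → ℚ
    cy j = coeffℤ L y (+ j)
    ch j = coeffℤ P h (+ j)
    tP≡0 : ∀ a t P → (a ℤ.- t ℤ.* P) ℤ.- (a ℤ.- + 0) ≡ (ℤ.- t) ℤ.* P
    tP≡0 = solve-∀
    ch-periodic : ∀ t → ch (t ℕ.* P) ≡ ch 0
    ch-periodic t = ⟪⟫-cong h (λ a → δ-cong-mod P (ℤS.divides (ℤ.- + t)
      (trans (cong (λ z → (a ℤ.- z) ℤ.- (a ℤ.- + 0)) (ℤP.pos-* t P)) (tP≡0 a (+ t) (+ P)))))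

  ⟪const⟫τ : ∀ q → ⟪ const q ⟫ τ ≡ q * (ι ℓ - 1ℚ)
  ⟪const⟫τ q = trans (⟪⟫-const q τ) (cong (q *_) (cong₂ (λ u v → u - v)
    (trans (cong (ι ℓ *_) (δ-∣ (L ℕD.∣0))) (ℚP.*-identityʳ (ι ℓ))) (δ-∣ (P ℕD.∣0))))

  -- ρ a = ℓ - 1 - τ a ≥ 0, and ρ a = 0 exactly when L ∣ a.
  ρ : ℤ → ℕ
  ρ z with L ∣? ℤ.∣ z ∣ | P ∣? ℤ.∣ z ∣
  ... | yes _ | _     = 0
  ... | no _  | yes _ = ℓ
  ... | no _  | no _  = ℓ ∸ 1

  ρ+τ≡ℓ-1 : 1 < ℓ → ∀ z → ι (ρ z) + τ z ≡ ι ℓ - 1ℚ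
  ρ+τ≡ℓ-1 1<ℓ z with L ∣? ℤ.∣ z ∣ | P ∣? ℤ.∣ z ∣
  ... | yes _   | yes _ = trans (ℚP.+-identityˡ _) (cong (_- 1ℚ) (ℚP.*-identityʳ (ι ℓ)))
  ... | yes L∣z | no P∤z = ⊥-elim (P∤z (ℕD.∣-trans (ℕD.n∣m*n ℓ) L∣z))
  ... | no _    | yes _ = solve 1 (λ l → l :+ (l :* con 0ℚ :+ (:- con 1ℚ)) := l :+ (:- con 1ℚ)) refl (ι ℓ)
  ... | no _    | no _  = begin
    ι (ℓ ∸ 1) + (ι ℓ * 0ℚ - 0ℚ)
      ≡⟨ solve 2 (λ m l → m :+ (l :* con 0ℚ :+ (:- con 0ℚ)) := m) refl (ι (ℓ ∸ 1)) (ι ℓ) ⟩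
    ι (ℓ ∸ 1)
      ≡⟨ solve 1 (λ m → m := (m :+ con 1ℚ) :+ (:- con 1ℚ)) refl (ι (ℓ ∸ 1)) ⟩
    (ι (ℓ ∸ 1) + 1ℚ) - 1ℚ
      ≡⟨ cong (_- 1ℚ) (trans (sym (ι-+ (ℓ ∸ 1) 1)) (cong ι (ℕP.m∸n+n≡m (ℕP.<⇒≤ 1<ℓ)))) ⟩
    ι ℓ - 1ℚ ∎
    where open ≡-Reasoning

  ρ≡0⇒L∣ : 1 < ℓ → ∀ z → ρ z ≡ 0 → L ∣ ℤ.∣ z ∣
  ρ≡0⇒L∣ 1<ℓ z ρz≡0 with L ∣? ℤ.∣ z ∣ | P ∣? ℤ.∣ z ∣
  ... | yes L∣z | _ = L∣z
  ... | no _ | yes _ = ⊥-elim (ℕP.<⇒≢ (ℕP.<-trans (s≤s z≤n) 1<ℓ) (sym ρz≡0))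
  ... | no _ | no _ = ⊥-elim (ℕP.<⇒≱ 1<ℓ (ℕP.m∸n≡0⇒m≤n ρz≡0))

  -- ⟪ S S̄ ⟫ τ = Σ_{v,w} τ(a v - a w), and τ ≤ ℓ - 1 with equality only on multiples of L.
  ∣Σζ^∣²≡n²⇒≡mod : 1 < ℓ → ∀ {A : Set} (xs : List A) (a : A → ℤ) →
    Eq ℓ (suc e') (Σζ^ xs a ⊗ conj (Σζ^ xs a)) (const (ι (length xs ℕ.* length xs))) →
    ∀ {v w} → v ∈ xs → w ∈ xs → L ∣ ℤ.∣ a v ℤ.- a w ∣
  ∣Σζ^∣²≡n²⇒≡mod 1<ℓ xs a norm v∈ w∈ =
    ρ≡0⇒L∣ 1<ℓ _ (∑ℕ≡0⇒≡0 xs _ (∑ℕ≡0⇒≡0 xs _ R≡0 v∈) w∈)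
    where
    S = Σζ^ xs a
    n = length xs
    ⟪Σζ^⟫ : ∀ g → ⟪ S ⟫ g ≡ ∑ xs (λ v → g (a v))
    ⟪Σζ^⟫ g = trans (⟪⟫-Σ xs _ g) (∑-cong xs (λ v → ⟪⟫-ζ^ (a v) g))
    ⟪SS̄⟫τ : ⟪ S ⊗ conj S ⟫ τ ≡ ∑ xs (λ v → ∑ xs (λ w → τ (a v ℤ.- a w)))
    ⟪SS̄⟫τ = trans (⟪⟫-⊗ S (conj S) τ)
      (trans (⟪⟫-cong S (λ b → trans (⟪⟫-conj S (λ c → τ (b ℤ.+ c))) (⟪Σζ^⟫ (λ c → τ (b ℤ.- c)))))
             (⟪Σζ^⟫ (λ b → ∑ xs (λ w → τ (b ℤ.- a w)))))
    R : ℕ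
    R = ∑ℕ xs (λ v → ∑ℕ xs (λ w → ρ (a v ℤ.- a w)))
    R+⟪SS̄⟫τ : ι R + ⟪ S ⊗ conj S ⟫ τ ≡ ι (n ℕ.* n) * (ι ℓ - 1ℚ)
    R+⟪SS̄⟫τ = begin
      ι R + ⟪ S ⊗ conj S ⟫ τ
        ≡⟨ cong₂ _+_ (trans (ι-∑ℕ xs _) (∑-cong xs (λ v → ι-∑ℕ xs _))) ⟪SS̄⟫τ ⟩
      ∑ xs (λ v → ∑ xs (λ w → ι (ρ (a v ℤ.- a w)))) + ∑ xs (λ v → ∑ xs (λ w → τ (a v ℤ.- a w)))
        ≡⟨ ∑-+ xs _ _ ⟨
      ∑ xs (λ v → ∑ xs (λ w → ι (ρ (a v ℤ.- a w))) + ∑ xs (λ w → τ (a v ℤ.- a w)))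
        ≡⟨ ∑-cong xs (λ v → trans (sym (∑-+ xs _ _)) (trans (∑-cong xs (λ w → ρ+τ≡ℓ-1 1<ℓ _)) (∑-const xs _))) ⟩
      ∑ xs (λ _ → ι n * (ι ℓ - 1ℚ))
        ≡⟨ ∑-const xs _ ⟩
      ι n * (ι n * (ι ℓ - 1ℚ))
        ≡⟨ ℚP.*-assoc (ι n) (ι n) _ ⟨
      (ι n * ι n) * (ι ℓ - 1ℚ)
        ≡⟨ cong (_* (ι ℓ - 1ℚ)) (ι-* n n) ⟨
      ι (n ℕ.* n) * (ι ℓ - 1ℚ) ∎
      where open ≡-Reasoning
    R≡0 : R ≡ 0
    R≡0 = ι≡0⇒≡0 R (begin
      ι R
        ≡⟨ solve 2 (λ r s → r := (r :+ s) :+ (:- s)) refl (ι R) _ ⟩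
      (ι R + ⟪ S ⊗ conj S ⟫ τ) - ⟪ S ⊗ conj S ⟫ τ
        ≡⟨ cong₂ _-_ R+⟪SS̄⟫τ (⟪⟫τ-resp-Eq {S ⊗ conj S} {const (ι (n ℕ.* n))} norm) ⟩
      ι (n ℕ.* n) * (ι ℓ - 1ℚ) - ⟪ const (ι (n ℕ.* n)) ⟫ τ
        ≡⟨ cong (λ t → ι (n ℕ.* n) * (ι ℓ - 1ℚ) - t) (⟪const⟫τ (ι (n ℕ.* n))) ⟩
      ι (n ℕ.* n) * (ι ℓ - 1ℚ) - ι (n ℕ.* n) * (ι ℓ - 1ℚ)
        ≡⟨ ℚP.+-inverseʳ (ι (n ℕ.* n) * (ι ℓ - 1ℚ)) ⟩
      0ℚ ∎)
      where open ≡-Reasoning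

  Monomial⇒Eq-const : ∀ {x s} → Monomial L x s (+ 0) → Eq ℓ (suc e') x (const s)
  Monomial⇒Eq-const {x} {s} (monomial x≐) =
    Eq-intro x (const s) [] λ j → trans (x≐ j) (sym (trans (ℚP.+-identityʳ _) (ℚP.+-identityʳ (s * δ L (+ 0 ℤ.- j)))))

  ≡mod⇒∣Σζ^∣²≡n² : ∀ {A : Set} (xs : List A) (a : A → ℤ) c →
    (∀ {v} → v ∈ xs → + L ℤS.∣ (a v ℤ.- c)) →
    Eq ℓ (suc e') (Σζ^ xs a ⊗ conj (Σζ^ xs a)) (const (ι (length xs ℕ.* length xs)))
  ≡mod⇒∣Σζ^∣²≡n² xs a c a≡c = Monomial⇒Eq-const
    (Monomial-≡ (sym (ι-* (length xs) (length xs))) (ℤP.+-inverseʳ c)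
      (Monomial-⊗ S≐ (Monomial-conj S≐)))
    where S≐ = Monomial-Σζ^ L xs a c a≡c

module _ {ℓ : ℕ} (ℓ-prime : Prime ℓ) where

  1<ℓ : 1 < ℓ
  1<ℓ = ℕ.nonTrivial⇒n>1 ℓ {{prime⇒nonTrivial ℓ-prime}}

  ℓ≢1 : ℓ ≢ 1
  ℓ≢1 ℓ≡1 = ℕP.<-irrefl (sym ℓ≡1) 1<ℓ

  ∤⇒coprime : ∀ {v} → ¬ ℓ ∣ v → Coprime v ℓ
  ∤⇒coprime ℓ∤v (d∣v , d∣ℓ) with prime⇒irreducible ℓ-prime d∣ℓ
  ... | inj₁ d≡1 = d≡1
  ... | inj₂ refl = ⊥-elim (ℓ∤v d∣v)

  ℓ∣ℓ^k : ∀ {k} → 1 ≤ k → ℓ ∣ ℓ ^ k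
  ℓ∣ℓ^k (s≤s {n = k} _) = ℕD.m∣m*n (ℓ ^ k)

  1<ℓ^k : ∀ {k} → 1 ≤ k → 1 < ℓ ^ k
  1<ℓ^k {k} 1≤k = ℕP.^-monoʳ-< ℓ 1<ℓ {0} {k} 1≤k

coprime-* : ∀ {a b c} → Coprime a b → Coprime a c → Coprime a (b ℕ.* c)
coprime-* a⊥b a⊥c {d} (d∣a , d∣bc) = a⊥c (d∣a , ℕC.coprime-divisor d⊥b d∣bc)
  where
  d⊥b : Coprime d _
  d⊥b (e∣d , e∣b) = a⊥b (ℕD.∣-trans e∣d d∣a , e∣b)

coprime-^ : ∀ {a b} → Coprime a b → ∀ k → Coprime a (b ^ k)
coprime-^ a⊥b zero (_ , d∣1) = ℕD.∣1⇒≡1 d∣1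
coprime-^ a⊥b (suc k) = coprime-* a⊥b (coprime-^ a⊥b k)

coprime-∣ʳ : ∀ {a b c} → Coprime a b → c ∣ b → Coprime a c
coprime-∣ʳ a⊥b c∣b (d∣a , d∣c) = a⊥b (d∣a , ℕD.∣-trans d∣c c∣b)

coprime-∣⇒*∣ : ∀ {a b x} → Coprime a b → a ∣ x → b ∣ x → a ℕ.* b ∣ x
coprime-∣⇒*∣ {a} {b} a⊥b (divides u x≡ua) b∣x
  with ℕC.coprime-divisor (ℕC.sym a⊥b) (subst (b ∣_) (trans x≡ua (ℕP.*-comm u a)) b∣x)
... | divides w u≡wb = divides w (begin
  _             ≡⟨ x≡ua ⟩
  u ℕ.* a       ≡⟨ cong (ℕ._* a) u≡wb ⟩
  w ℕ.* b ℕ.* a ≡⟨ ℕP.*-assoc w b a ⟩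
  w ℕ.* (b ℕ.* a) ≡⟨ cong (w ℕ.*_) (ℕP.*-comm b a) ⟩
  w ℕ.* (a ℕ.* b) ∎)
  where open ≡-Reasoning

^-split : ∀ ℓ {k e} → k ≤ e → ℓ ^ k ℕ.* ℓ ^ (e ∸ k) ≡ ℓ ^ e
^-split ℓ {k} {e} k≤e = trans (sym (ℕP.^-distribˡ-+-* ℓ k (e ∸ k))) (cong (ℓ ^_) (ℕP.m+[n∸m]≡n k≤e))

^-monoʳ-∣ : ∀ ℓ {a b} → a ≤ b → ℓ ^ a ∣ ℓ ^ b
^-monoʳ-∣ ℓ {a} {b} a≤b = divides (ℓ ^ (b ∸ a)) (trans (sym (^-split ℓ a≤b)) (ℕP.*-comm (ℓ ^ a) _))

^∣∧∤⇒≡0 : ∀ {ℓ D M} → ℓ ^ D ∣ M → ¬ ℓ ∣ M → D ≡ 0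
^∣∧∤⇒≡0 {D = zero} _ _ = refl
^∣∧∤⇒≡0 {ℓ} {suc D} ℓ^1+D∣M ℓ∤M = ⊥-elim (ℓ∤M (ℕD.∣-trans (ℕD.m∣m*n (ℓ ^ D)) ℓ^1+D∣M))

eval-cong : ∀ F {m a b} → m ℤS.∣ (a ℤ.- b) → m ℤS.∣ (eval F a ℤ.- eval F b)
eval-cong [] _ = ℤS.divides (+ 0) refl
eval-cong (c ∷ cs) {m} {a} {b} m∣a-b = subst (m ℤS.∣_) (sym (expand c a b (eval cs a) (eval cs b)))
  (ℤS.∣m∣n⇒∣m+n (ℤS.∣m⇒∣m*n (eval cs a) m∣a-b) (ℤS.∣n⇒∣m*n b (eval-cong cs m∣a-b)))
  where
  expand : ∀ c a b A B → (c ℤ.+ a ℤ.* A) ℤ.- (c ℤ.+ b ℤ.* B) ≡ (a ℤ.- b) ℤ.* A ℤ.+ b ℤ.* (A ℤ.- B)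
  expand = solve-∀

private
  lift : ∀ u v w z → 1 ℕ.+ u ℕ.* v ≡ w ℕ.* z → + 1 ℤ.+ + u ℤ.* + v ≡ + w ℤ.* + z
  lift u v w z eq = trans (cong (λ t → + 1 ℤ.+ t) (sym (ℤP.pos-* u v))) (trans (cong +_ eq) (ℤP.pos-* w z))

bézout : ∀ a b → Coprime a b → ∃₂ λ A B → A ℤ.* + a ℤ.+ B ℤ.* + b ≡ + 1
bézout a b a⊥b with ℕC.coprime-Bézout a⊥b
... | Bézout.+- x y eq = + x , ℤ.- + y , trans (cong (λ u → u ℤ.+ (ℤ.- + y) ℤ.* + b) (sym (lift y b x a eq))) (cancel (+ y) (+ b))
  where
  cancel : ∀ y b → (+ 1 ℤ.+ y ℤ.* b) ℤ.+ (ℤ.- y) ℤ.* b ≡ + 1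
  cancel = solve-∀
... | Bézout.-+ x y eq = ℤ.- + x , + y , trans (cong (λ u → (ℤ.- + x) ℤ.* + a ℤ.+ u) (sym (lift x a y b eq))) (cancel (+ x) (+ a))
  where
  cancel : ∀ x a → (ℤ.- x) ℤ.* a ℤ.+ (+ 1 ℤ.+ x ℤ.* a) ≡ + 1
  cancel = solve-∀

bézout-ℤ : ∀ n b → Coprime ℤ.∣ n ∣ b → ∃₂ λ A B → A ℤ.* n ℤ.+ B ℤ.* + b ≡ + 1
bézout-ℤ (+ k) b k⊥b = bézout k b k⊥b
bézout-ℤ -[1+ k ] b k⊥b with bézout (suc k) b k⊥b
... | A , B , eq = ℤ.- A , B , trans (cong (ℤ._+ B ℤ.* + b) (neg-*-neg A (+ suc k))) eq
  where
  neg-*-neg : ∀ A n → (ℤ.- A) ℤ.* (ℤ.- n) ≡ A ℤ.* n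
  neg-*-neg = solve-∀

boundary : ∀ {P : ℕ → Set} → Decidable P → ∀ D → P 0 → ¬ P D → ∃ λ a → a < D × P a × ¬ P (suc a)
boundary P? zero p0 ¬pD = ⊥-elim (¬pD p0)
boundary P? (suc D) p0 ¬pD with P? D
... | yes pD = D , ℕP.≤-refl , pD , ¬pD
... | no ¬pD' with boundary P? D p0 ¬pD'
...   | a , a<D , pa , ¬pa = a , ℕP.m≤n⇒m≤1+n a<D , pa , ¬pa

-- Write n = n₁ℓ^a with ℓ ∤ n₁, so a < D, and multiply αn₁ + βℓ = 1 by ℓ^e' = ℓ^(D-1-a)·ℓ^a·ℓ^(1+e'-D).
∤⇒ℓ^e′-combination : ∀ {ℓ e' D} (n : ℤ) → Prime ℓ → D ≤ suc e' → ¬ (ℓ ^ D ∣ ℤ.∣ n ∣) →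
  ∃₂ λ t β → t ℤ.* (n ℤ.* + (ℓ ^ (suc e' ∸ D))) ℤ.+ β ℤ.* + (ℓ ^ suc e') ≡ + (ℓ ^ e')
∤⇒ℓ^e′-combination {ℓ} {e'} {D} n ℓ-prime D≤e ℓ^D∤n
  with boundary (λ a → ℓ ^ a ∣? ℤ.∣ n ∣) D (ℕD.1∣ _) ℓ^D∤n
... | a , a<D , ℓ^a∣n , ℓ^1+a∤n with ℤS.∣ᵤ⇒∣ {+ (ℓ ^ a)} {n} ℓ^a∣n
...   | ℤS.divides n₁ n≡n₁ℓ^a with bézout-ℤ n₁ ℓ (∤⇒coprime ℓ-prime ℓ∤n₁)
  where
  ℓ∤n₁ : ¬ ℓ ∣ ℤ.∣ n₁ ∣
  ℓ∤n₁ ℓ∣n₁ = ℓ^1+a∤n (subst (ℓ ℕ.* ℓ ^ a ∣_) (trans (sym (ℤP.abs-* n₁ _)) (cong ℤ.∣_∣ (sym n≡n₁ℓ^a)))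
                              (ℕD.*-monoˡ-∣ (ℓ ^ a) ℓ∣n₁))
...     | α , β , αn₁+βℓ≡1 = α ℤ.* + (ℓ ^ b) , β , (begin
  α ℤ.* + (ℓ ^ b) ℤ.* (n ℤ.* + (ℓ ^ c)) ℤ.+ β ℤ.* + (ℓ ^ suc e')
    ≡⟨ cong₂ (λ u v → α ℤ.* + (ℓ ^ b) ℤ.* (u ℤ.* + (ℓ ^ c)) ℤ.+ β ℤ.* v) n≡n₁ℓ^a (ℤP.pos-* ℓ (ℓ ^ e')) ⟩
  α ℤ.* + (ℓ ^ b) ℤ.* (n₁ ℤ.* + (ℓ ^ a) ℤ.* + (ℓ ^ c)) ℤ.+ β ℤ.* (+ ℓ ℤ.* + (ℓ ^ e'))
    ≡⟨ cong (λ u → α ℤ.* + (ℓ ^ b) ℤ.* (n₁ ℤ.* + (ℓ ^ a) ℤ.* + (ℓ ^ c)) ℤ.+ β ℤ.* (+ ℓ ℤ.* u)) ℓ^e'≡ ⟩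
  α ℤ.* + (ℓ ^ b) ℤ.* (n₁ ℤ.* + (ℓ ^ a) ℤ.* + (ℓ ^ c)) ℤ.+ β ℤ.* (+ ℓ ℤ.* (+ (ℓ ^ b) ℤ.* + (ℓ ^ a) ℤ.* + (ℓ ^ c)))
    ≡⟨ factor α n₁ β (+ ℓ) (+ (ℓ ^ b)) (+ (ℓ ^ a)) (+ (ℓ ^ c)) ⟩
  (α ℤ.* n₁ ℤ.+ β ℤ.* + ℓ) ℤ.* (+ (ℓ ^ b) ℤ.* + (ℓ ^ a) ℤ.* + (ℓ ^ c))
    ≡⟨ cong (ℤ._* (+ (ℓ ^ b) ℤ.* + (ℓ ^ a) ℤ.* + (ℓ ^ c))) αn₁+βℓ≡1 ⟩
  + 1 ℤ.* (+ (ℓ ^ b) ℤ.* + (ℓ ^ a) ℤ.* + (ℓ ^ c))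
    ≡⟨ trans (ℤP.*-identityˡ _) (sym ℓ^e'≡) ⟩
  + (ℓ ^ e') ∎)
  where
  open ≡-Reasoning
  b = D ∸ suc a
  c = suc e' ∸ D
  e'≡b+a+c : e' ≡ b ℕ.+ a ℕ.+ c
  e'≡b+a+c = ℕP.suc-injective (begin
    suc e'                    ≡⟨ ℕP.m+[n∸m]≡n D≤e ⟨
    D ℕ.+ c                   ≡⟨ cong (ℕ._+ c) (ℕP.m+[n∸m]≡n a<D) ⟨
    suc a ℕ.+ b ℕ.+ c         ≡⟨ cong (λ z → suc z ℕ.+ c) (ℕP.+-comm a b) ⟩
    suc (b ℕ.+ a ℕ.+ c)       ∎)
  ℓ^e'≡ : + (ℓ ^ e') ≡ + (ℓ ^ b) ℤ.* + (ℓ ^ a) ℤ.* + (ℓ ^ c)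
  ℓ^e'≡ = begin
    + (ℓ ^ e')                              ≡⟨ cong (λ z → + (ℓ ^ z)) e'≡b+a+c ⟩
    + (ℓ ^ (b ℕ.+ a ℕ.+ c))                 ≡⟨ cong +_ (ℕP.^-distribˡ-+-* ℓ (b ℕ.+ a) c) ⟩
    + (ℓ ^ (b ℕ.+ a) ℕ.* ℓ ^ c)             ≡⟨ cong (λ z → + (z ℕ.* ℓ ^ c)) (ℕP.^-distribˡ-+-* ℓ b a) ⟩
    + (ℓ ^ b ℕ.* ℓ ^ a ℕ.* ℓ ^ c)           ≡⟨ ℤP.pos-* (ℓ ^ b ℕ.* ℓ ^ a) (ℓ ^ c) ⟩
    + (ℓ ^ b ℕ.* ℓ ^ a) ℤ.* + (ℓ ^ c)       ≡⟨ cong (ℤ._* + (ℓ ^ c)) (ℤP.pos-* (ℓ ^ b) (ℓ ^ a)) ⟩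
    + (ℓ ^ b) ℤ.* + (ℓ ^ a) ℤ.* + (ℓ ^ c)   ∎
  factor : ∀ α n₁ β l B A C →
    α ℤ.* B ℤ.* (n₁ ℤ.* A ℤ.* C) ℤ.+ β ℤ.* (l ℤ.* (B ℤ.* A ℤ.* C)) ≡ (α ℤ.* n₁ ℤ.+ β ℤ.* l) ℤ.* (B ℤ.* A ℤ.* C)
  factor = solve-∀

ConstOnUnits : Poly → ℕ → ℕ → Set
ConstOnUnits F ℓ k = ∀ {v} → v ∈ unitsMod ℓ k → + (ℓ ^ k) ℤS.∣ (eval F (+ v) ℤ.- eval F (+ 1))

module _ {ℓ : ℕ} (ℓ-prime : Prime ℓ) where

  length-unitsMod : ∀ {k} → 1 ≤ k → length (unitsMod ℓ k) ≡ φ (ℓ ^ k)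
  length-unitsMod {k} 1≤k =
    cong length (ListP.filter-≐ (λ v → ¬? (ℓ ∣? v)) (λ v → gcd v (ℓ ^ k) ℕ.≟ 1) (to , from) (upTo (ℓ ^ k)))
    where
    to : ∀ {v} → ¬ ℓ ∣ v → gcd v (ℓ ^ k) ≡ 1
    to ℓ∤v = ℕC.coprime⇒gcd≡1 (coprime-^ (∤⇒coprime ℓ-prime ℓ∤v) k)
    from : ∀ {v} → gcd v (ℓ ^ k) ≡ 1 → ¬ ℓ ∣ v
    from gcd≡1 ℓ∣v = ℓ≢1 ℓ-prime (ℕC.gcd≡1⇒coprime gcd≡1 (ℓ∣v , ℓ∣ℓ^k ℓ-prime 1≤k))

  1∈unitsMod : ∀ {k} → 1 ≤ k → 1 ∈ unitsMod ℓ k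
  1∈unitsMod 1≤k =
    ∈P.∈-filter⁺ (λ v → ¬? (ℓ ∣? v)) (∈P.∈-upTo⁺ (1<ℓ^k ℓ-prime 1≤k)) (ℓ≢1 ℓ-prime ∘ ℕD.∣1⇒≡1)

  1≤φ[ℓ^k] : ∀ {k} → 1 ≤ k → 1 ≤ φ (ℓ ^ k)
  1≤φ[ℓ^k] 1≤k = subst (1 ≤_) (length-unitsMod 1≤k) (nonempty (1∈unitsMod 1≤k))
    where
    nonempty : ∀ {x : ℕ} {xs} → x ∈ xs → 1 ≤ length xs
    nonempty {xs = _ ∷ _} _ = s≤s z≤n

module _ {F : Poly} {M ℓ D m : ℕ} (ℓ-prime : Prime ℓ) (M≡mℓ^D : M ≡ m ℕ.* ℓ ^ D) (ℓ∤m : ¬ ℓ ∣ m) where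

  -- A unit v mod ℓ^k lifts (by CRT) to v' ≡ v mod ℓ^k, v' ≡ 1 mod m, which is a unit mod M.
  constOnUnits-≤ : GoodMod F M → ∀ {k} → 1 ≤ k → k ≤ D → ConstOnUnits F ℓ k
  constOnUnits-≤ good {k} 1≤k k≤D {v} v∈
    with bézout (ℓ ^ k) m (ℕC.sym (coprime-^ (∤⇒coprime ℓ-prime ℓ∤m) k))
  ... | A , B , Aℓ^k+Bm≡1 =
    subst (+ (ℓ ^ k) ℤS.∣_) (telescope (eval F v') (eval F (+ v)) (eval F (+ 1)))
      (ℤS.∣m∣n⇒∣m-n (ℤS.∣ᵤ⇒∣ {+ (ℓ ^ k)} {eval F v' ℤ.- eval F (+ 1)} (ℕD.∣-trans ℓ^k∣M (good v' v'⊥M)))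
                    (eval-cong F v'≡v))
    where
    ℓ∤v : ¬ ℓ ∣ v
    ℓ∤v = proj₂ (∈P.∈-filter⁻ (λ v → ¬? (ℓ ∣? v)) {v} {upTo (ℓ ^ k)} v∈)
    v' : ℤ
    v' = + v ℤ.* B ℤ.* + m ℤ.+ A ℤ.* + (ℓ ^ k)
    v'≡v : + (ℓ ^ k) ℤS.∣ (v' ℤ.- + v)
    v'≡v = ℤS.divides (A ℤ.- + v ℤ.* A)
      (trans (cong (λ u → v' ℤ.- u) (sym (trans (cong (λ u → + v ℤ.* u) Aℓ^k+Bm≡1) (ℤP.*-identityʳ (+ v)))))
             (e₁ (+ v) B (+ m) A (+ (ℓ ^ k))))
      where
      e₁ : ∀ v B m A L → (v ℤ.* B ℤ.* m ℤ.+ A ℤ.* L) ℤ.- v ℤ.* (A ℤ.* L ℤ.+ B ℤ.* m) ≡ (A ℤ.- v ℤ.* A) ℤ.* L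
      e₁ = solve-∀
    v'≡1 : + m ℤS.∣ (v' ℤ.- + 1)
    v'≡1 = ℤS.divides (+ v ℤ.* B ℤ.- B) (trans (cong (λ u → v' ℤ.- u) (sym Aℓ^k+Bm≡1)) (e₂ (+ v) B (+ m) A (+ (ℓ ^ k))))
      where
      e₂ : ∀ v B m A L → (v ℤ.* B ℤ.* m ℤ.+ A ℤ.* L) ℤ.- (A ℤ.* L ℤ.+ B ℤ.* m) ≡ (v ℤ.* B ℤ.- B) ℤ.* m
      e₂ = solve-∀
    back : ∀ x y → x ℤ.- (x ℤ.- y) ≡ y
    back = solve-∀
    v'⊥m : Coprime ℤ.∣ v' ∣ m
    v'⊥m (d∣v' , d∣m) = ℕD.∣1⇒≡1 (ℤS.∣⇒∣ᵤ (subst (+ _ ℤS.∣_) (back v' (+ 1))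
      (ℤS.∣m∣n⇒∣m-n (ℤS.∣ᵤ⇒∣ {+ _} {v'} d∣v') (ℤS.∣-trans (ℤS.∣ᵤ⇒∣ {+ _} {+ m} d∣m) v'≡1))))
    ℓ∤v' : ¬ ℓ ∣ ℤ.∣ v' ∣
    ℓ∤v' ℓ∣v' = ℓ∤v (ℤS.∣⇒∣ᵤ (subst (+ ℓ ℤS.∣_) (back v' (+ v))
      (ℤS.∣m∣n⇒∣m-n (ℤS.∣ᵤ⇒∣ {+ ℓ} {v'} ℓ∣v')
                    (ℤS.∣-trans (ℤS.∣ᵤ⇒∣ {+ ℓ} {+ (ℓ ^ k)} (ℓ∣ℓ^k ℓ-prime 1≤k)) v'≡v))))
    v'⊥M : Coprime ℤ.∣ v' ∣ M
    v'⊥M = subst (Coprime ℤ.∣ v' ∣) (sym M≡mℓ^D) (coprime-* v'⊥m (coprime-^ (∤⇒coprime ℓ-prime ℓ∤v') D))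
    ℓ^k∣M : ℓ ^ k ∣ M
    ℓ^k∣M = ℕD.∣-trans (^-monoʳ-∣ ℓ k≤D) (subst (ℓ ^ D ∣_) (sym M≡mℓ^D) (ℕD.n∣m*n m))
    telescope : ∀ a b c → (a ℤ.- c) ℤ.- (a ℤ.- b) ≡ b ℤ.- c
    telescope = solve-∀

  -- Otherwise m·ℓ^k would be a good divisor of q exceeding M.
  constOnUnits⇒≤ : ∀ {q e} → IsM F q M → ℓ ^ e ∣ q →
    ∀ {k} → 1 ≤ k → k ≤ e → ConstOnUnits F ℓ k → k ≤ D
  constOnUnits⇒≤ {q} (1≤M , M∣q , good , maximal) ℓ^e∣q {k} 1≤k k≤e onUnits with k ℕ.≤? D
  ... | yes k≤D = k≤D
  ... | no k≰D = ⊥-elim (ℕP.<⇒≱ (ℕP.^-monoʳ-< ℓ (1<ℓ ℓ-prime) D<k) (ℕP.*-cancelˡ-≤ m mℓ^k≤mℓ^D))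
    where
    instance
      ℓ^k≢0 : NonZero (ℓ ^ k)
      ℓ^k≢0 = ℕP.m^n≢0 ℓ k {{prime⇒nonZero ℓ-prime}}
      m≢0 : NonZero m
      m≢0 = ℕ.≢-nonZero λ { refl → ℕP.<⇒≱ 1≤M (ℕP.≤-reflexive M≡mℓ^D) }
    D<k : D < k
    D<k = ℕP.≰⇒> k≰D
    m⊥ℓ^k : Coprime m (ℓ ^ k)
    m⊥ℓ^k = coprime-^ (∤⇒coprime ℓ-prime ℓ∤m) k
    m∣M : m ∣ M
    m∣M = subst (m ∣_) (sym M≡mℓ^D) (ℕD.m∣m*n (ℓ ^ D))
    M∣mℓ^k : M ∣ m ℕ.* ℓ ^ k
    M∣mℓ^k = subst (_∣ m ℕ.* ℓ ^ k) (sym M≡mℓ^D) (ℕD.*-monoʳ-∣ m (^-monoʳ-∣ ℓ (ℕP.<⇒≤ D<k)))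
    ℓ^k∣F[v]-F[1] : ∀ v → Coprime ℤ.∣ v ∣ (m ℕ.* ℓ ^ k) → ℓ ^ k ∣ ℤ.∣ eval F v ℤ.- eval F (+ 1) ∣
    ℓ^k∣F[v]-F[1] v v⊥ = ℤS.∣⇒∣ᵤ (subst (+ (ℓ ^ k) ℤS.∣_) (telescope (eval F v) (eval F (+ r)) (eval F (+ 1)))
                                    (ℤS.∣m∣n⇒∣m+n (eval-cong F v≡r) (onUnits r∈)))
      where
      r = v ℤ.%ℕ ℓ ^ k
      v≡r : + (ℓ ^ k) ℤS.∣ (v ℤ.- + r)
      v≡r = ℤS.divides (v ℤ./ℕ ℓ ^ k)
        (trans (cong (ℤ._- + r) (ℤDM.a≡a%ℕn+[a/ℕn]*n v (ℓ ^ k))) (cancel (+ r) (v ℤ./ℕ ℓ ^ k) (+ (ℓ ^ k))))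
        where
        cancel : ∀ a q L → (a ℤ.+ q ℤ.* L) ℤ.- a ≡ q ℤ.* L
        cancel = solve-∀
      ℓ∤r : ¬ ℓ ∣ r
      ℓ∤r ℓ∣r = ℓ≢1 ℓ-prime (v⊥ (ℓ∣v , ℕD.∣-trans (ℓ∣ℓ^k ℓ-prime 1≤k) (ℕD.n∣m*n m)))
        where
        ℓ∣v : ℓ ∣ ℤ.∣ v ∣
        ℓ∣v = ℤS.∣⇒∣ᵤ (subst (+ ℓ ℤS.∣_) (sym (ℤDM.a≡a%ℕn+[a/ℕn]*n v (ℓ ^ k)))
                (ℤS.∣m∣n⇒∣m+n (ℤS.∣ᵤ⇒∣ {+ ℓ} {+ r} ℓ∣r)
                              (ℤS.∣n⇒∣m*n (v ℤ./ℕ ℓ ^ k) (ℤS.∣ᵤ⇒∣ {+ ℓ} {+ (ℓ ^ k)} (ℓ∣ℓ^k ℓ-prime 1≤k)))))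
      r∈ : r ∈ unitsMod ℓ k
      r∈ = ∈P.∈-filter⁺ (λ v → ¬? (ℓ ∣? v)) (∈P.∈-upTo⁺ (ℤDM.n%ℕd<d v (ℓ ^ k))) ℓ∤r
      telescope : ∀ a b c → (a ℤ.- b) ℤ.+ (b ℤ.- c) ≡ a ℤ.- c
      telescope = solve-∀
    good' : GoodMod F (m ℕ.* ℓ ^ k)
    good' v v⊥ = coprime-∣⇒*∣ m⊥ℓ^k (ℕD.∣-trans m∣M (good v (coprime-∣ʳ v⊥ M∣mℓ^k))) (ℓ^k∣F[v]-F[1] v v⊥)
    mℓ^k≤mℓ^D : m ℕ.* ℓ ^ k ≤ m ℕ.* ℓ ^ D
    mℓ^k≤mℓ^D = subst (m ℕ.* ℓ ^ k ≤_) M≡mℓ^D (maximal (m ℕ.* ℓ ^ k)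
      (ℕP.*-mono-≤ (ℕ.>-nonZero⁻¹ m) (ℕ.>-nonZero⁻¹ (ℓ ^ k)))
      (coprime-∣⇒*∣ m⊥ℓ^k (ℕD.∣-trans m∣M M∣q) (ℕD.∣-trans (^-monoʳ-∣ ℓ k≤e) ℓ^e∣q)) good')

rRange≡ : ∀ ℓ xs → filter (λ r → ¬? (ℓ ∣? r)) (filter (λ r → 1 ℕ.≤? r) xs) ≡ filter (λ r → ¬? (ℓ ∣? r)) xs
rRange≡ ℓ [] = refl
rRange≡ ℓ (zero ∷ xs) with ℓ ∣? 0
... | yes _ = rRange≡ ℓ xs
... | no ℓ∤0 = ⊥-elim (ℓ∤0 (ℓ ℕD.∣0))
rRange≡ ℓ (suc x ∷ xs) with ℓ ∣? suc x
... | yes _ = rRange≡ ℓ xs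
... | no _ = cong (suc x ∷_) (rRange≡ ℓ xs)

∑-multiples : ∀ ℓ .{{_ : NonZero ℓ}} m g →
  ∑ (filter (ℓ ∣?_) (upTo (ℓ ℕ.* m))) g ≡ ∑ (upTo m) (λ i → g (ℓ ℕ.* i))
∑-multiples ℓ m g = trans (∑-filter (upTo (ℓ ℕ.* m))) (blocks m)
  where
  g? : ℕ → ℚ
  g? x with ℓ ∣? x
  ... | yes _ = g x
  ... | no _ = 0ℚ
  ∑-filter : ∀ xs → ∑ (filter (ℓ ∣?_) xs) g ≡ ∑ xs g?
  ∑-filter [] = refl
  ∑-filter (x ∷ xs) with ℓ ∣? x
  ... | yes _ = cong (λ t → g x + t) (∑-filter xs)
  ... | no _ = trans (∑-filter xs) (sym (ℚP.+-identityˡ _))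
  g?-block : ∀ m i → i < ℓ → g? (ℓ ℕ.* m ℕ.+ i) ≡ g (ℓ ℕ.* m ℕ.+ i) * δₙ i 0
  g?-block m zero _ with ℓ ∣? (ℓ ℕ.* m ℕ.+ 0)
  ... | yes _ = sym (ℚP.*-identityʳ _)
  ... | no ℓ∤ = ⊥-elim (ℓ∤ (subst (ℓ ∣_) (sym (ℕP.+-identityʳ _)) (ℕD.m∣m*n m)))
  g?-block m (suc i) i<ℓ with ℓ ∣? (ℓ ℕ.* m ℕ.+ suc i)
  ... | yes ℓ∣ = ⊥-elim (ℕP.<-irrefl refl (ℕP.≤-trans i<ℓ (ℕD.∣⇒≤ (ℕD.∣m+n∣m⇒∣n ℓ∣ (ℕD.m∣m*n m)))))
  ... | no _ = sym (ℚP.*-zeroʳ (g (ℓ ℕ.* m ℕ.+ suc i)))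
  blocks : ∀ m → ∑ (upTo (ℓ ℕ.* m)) g? ≡ ∑ (upTo m) (λ i → g (ℓ ℕ.* i))
  blocks zero = cong (λ k → ∑ (upTo k) g?) (ℕP.*-zeroʳ ℓ)
  blocks (suc m) = begin
    ∑ (upTo (ℓ ℕ.* suc m)) g?
      ≡⟨ cong (λ k → ∑ (upTo k) g?) (trans (ℕP.*-suc ℓ m) (ℕP.+-comm ℓ (ℓ ℕ.* m))) ⟩
    ∑ (upTo (ℓ ℕ.* m ℕ.+ ℓ)) g?
      ≡⟨ ∑-upTo-+ (ℓ ℕ.* m) ℓ g? ⟩
    ∑ (upTo (ℓ ℕ.* m)) g? + ∑ (upTo ℓ) (λ i → g? (ℓ ℕ.* m ℕ.+ i))
      ≡⟨ cong₂ _+_ (blocks m) (trans (∑-upTo-cong ℓ (g?-block m))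
                                     (∑-δₙ ℓ 0 (λ i → g (ℓ ℕ.* m ℕ.+ i)) (ℕ.>-nonZero⁻¹ ℓ))) ⟩
    ∑ (upTo m) (λ i → g (ℓ ℕ.* i)) + g (ℓ ℕ.* m ℕ.+ 0)
      ≡⟨ cong (λ k → ∑ (upTo m) (λ i → g (ℓ ℕ.* i)) + g k) (ℕP.+-identityʳ _) ⟩
    ∑ (upTo m) (λ i → g (ℓ ℕ.* i)) + g (ℓ ℕ.* m)
      ≡⟨ ∑-upTo-suc m (λ i → g (ℓ ℕ.* i)) ⟨
    ∑ (upTo (suc m)) (λ i → g (ℓ ℕ.* i)) ∎
    where open ≡-Reasoning

∑-cyclic : ∀ N .{{_ : NonZero N}} (f : ℤ → ℚ) s → (∀ x → f (x ℤ.+ + N ℤ.* s) ≡ f x) →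
  ∑ (upTo N) (λ r → f (+ r ℤ.* s ℤ.- s)) ≡ ∑ (upTo N) (λ r → f (+ r ℤ.* s))
∑-cyclic (suc N) f s f-periodic = begin
  f (+ 0 ℤ.* s ℤ.- s) + ∑ (List.applyUpTo suc N) (λ r → f (+ r ℤ.* s ℤ.- s))
    ≡⟨ cong₂ _+_ (trans (sym (f-periodic _)) (cong f (wrap (+ N) s)))
                 (trans (cong (λ rs → ∑ rs (λ r → f (+ r ℤ.* s ℤ.- s))) (sym (ListP.map-upTo suc N)))
                 (trans (∑-map suc (upTo N) _) (∑-cong (upTo N) (λ r → cong f (step (+ r) s))))) ⟩
  f (+ N ℤ.* s) + ∑ (upTo N) (λ r → f (+ r ℤ.* s))
    ≡⟨ ℚP.+-comm (f (+ N ℤ.* s)) _ ⟩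
  ∑ (upTo N) (λ r → f (+ r ℤ.* s)) + f (+ N ℤ.* s)
    ≡⟨ ∑-upTo-suc N (λ r → f (+ r ℤ.* s)) ⟨
  ∑ (upTo (suc N)) (λ r → f (+ r ℤ.* s)) ∎
  where
  open ≡-Reasoning
  wrap : ∀ N s → (+ 0 ℤ.* s ℤ.- s) ℤ.+ (+ 1 ℤ.+ N) ℤ.* s ≡ N ℤ.* s
  wrap = solve-∀
  step : ∀ r s → (+ 1 ℤ.+ r) ℤ.* s ℤ.- s ≡ r ℤ.* s
  step = solve-∀

module Layers (F : Poly) (w : ℤ) (ℓ e J : ℕ) .{{_ : NonZero ℓ}} where

  L : ℕ
  L = ℓ ^ e

  n : ℤ
  n = eval F (+ 1) ℤ.* + J ℤ.- w

  -- ζ^(θ k r) = exp(2πi·rn/ℓ^k); T k and G k are the coefficient functions of the sums of these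
  -- over the units r mod ℓ^k and over all r < ℓ^k.
  θ : ℕ → ℕ → ℤ
  θ k r = (+ r ℤ.* n) ℤ.* + (ℓ ^ (e ∸ k))

  T G : ℕ → ℤ → ℚ
  T k j = ∑ (rRange ℓ k) (λ r → δ L (θ k r ℤ.- j))
  G k j = ∑ (upTo (ℓ ^ k)) (λ r → δ L (θ k r ℤ.- j))

  module _ {k} (k≤e : k ≤ e) (onUnits : ConstOnUnits F ℓ k) (1≤k : 1 ≤ k) (ℓ-prime : Prime ℓ) where

    Monomial-Ssum : ∀ r → Monomial L (Ssum F ℓ e k r) (ι (φ (ℓ ^ k))) ((r ℤ.* eval F (+ 1)) ℤ.* + (ℓ ^ (e ∸ k)))
    Monomial-Ssum r = Monomial-≡ (cong ι (length-unitsMod ℓ-prime 1≤k)) refl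
      (Monomial-Σζ^ L (unitsMod ℓ k) _ _ λ {v} v∈ → divisible (onUnits v∈))
      where
      scale-∣ : ∀ r a b q m p → a ℤ.- b ≡ q ℤ.* m → (r ℤ.* a) ℤ.* p ℤ.- (r ℤ.* b) ℤ.* p ≡ (r ℤ.* q) ℤ.* (m ℤ.* p)
      scale-∣ r a b q m p eq = trans (factor r a b p) (trans (cong (λ z → r ℤ.* z ℤ.* p) eq) (regroup r q m p))
        where
        factor : ∀ r a b p → (r ℤ.* a) ℤ.* p ℤ.- (r ℤ.* b) ℤ.* p ≡ r ℤ.* (a ℤ.- b) ℤ.* p
        factor = solve-∀
        regroup : ∀ r q m p → r ℤ.* (q ℤ.* m) ℤ.* p ≡ (r ℤ.* q) ℤ.* (m ℤ.* p)
        regroup = solve-∀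
      divisible : ∀ {v} → + (ℓ ^ k) ℤS.∣ (eval F (+ v) ℤ.- eval F (+ 1)) →
        + L ℤS.∣ ((r ℤ.* eval F (+ v)) ℤ.* + (ℓ ^ (e ∸ k)) ℤ.- (r ℤ.* eval F (+ 1)) ℤ.* + (ℓ ^ (e ∸ k)))
      divisible {v} (ℤS.divides q eq) = ℤS.divides (r ℤ.* q)
        (trans (scale-∣ r _ _ q (+ (ℓ ^ k)) (+ (ℓ ^ (e ∸ k))) eq)
               (cong ((r ℤ.* q) ℤ.*_) (trans (sym (ℤP.pos-* (ℓ ^ k) _)) (cong +_ (^-split ℓ k≤e)))))

    coeffℤ-H : ∀ j → coeffℤ L (H F w ℓ e k J) j ≡ T k j
    coeffℤ-H j = trans (⟪⟫-Σ (rRange ℓ k) _ _)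
      (∑-cong (rRange ℓ k) (λ r → trans (coeffℤ-≐ (Monomial-term r) j) (ℚP.*-identityˡ _)))
      where
      exponent : ∀ r w f J p → (ℤ.- (r ℤ.* w)) ℤ.* p ℤ.+ J ℤ.* ((r ℤ.* f) ℤ.* p) ≡ (r ℤ.* (f ℤ.* J ℤ.- w)) ℤ.* p
      exponent = solve-∀
      Monomial-term : ∀ r → Monomial L (ex ℓ e k (ℤ.- (+ r ℤ.* w)) ⊗ pow (scale (recip (φ (ℓ ^ k))) (Ssum F ℓ e k (+ r))) J)
                                       1ℚ (θ k r)
      Monomial-term r = Monomial-≡ (ℚP.*-identityˡ 1ℚ) (exponent (+ r) w (eval F (+ 1)) (+ J) (+ (ℓ ^ (e ∸ k))))
        (Monomial-⊗ {c = (ℤ.- (+ r ℤ.* w)) ℤ.* + (ℓ ^ (e ∸ k))} (Monomial-ζ^ L _)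
          (Monomial-pow (Monomial-≡ (recip-*-ι _ (1≤φ[ℓ^k] ℓ-prime 1≤k)) refl
                          (Monomial-scale (recip (φ (ℓ ^ k))) (Monomial-Ssum (+ r)))) J))

  -- Residues r < ℓ^(k+1) split into units, which make up T (k+1), and multiples ℓ·i, which make up G k.
  G-suc : ∀ {k} → suc k ≤ e → ∀ j → G (suc k) j ≡ T (suc k) j + G k j
  G-suc {k} k<e j = begin
    ∑ (upTo (ℓ ℕ.* ℓ ^ k)) f
      ≡⟨ ∑-partition (ℓ ∣?_) (upTo (ℓ ℕ.* ℓ ^ k)) f ⟩
    ∑ (filter (λ x → ¬? (ℓ ∣? x)) (upTo (ℓ ℕ.* ℓ ^ k))) f + ∑ (filter (ℓ ∣?_) (upTo (ℓ ℕ.* ℓ ^ k))) f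
      ≡⟨ cong₂ _+_ (cong (λ rs → ∑ rs f) (sym (rRange≡ ℓ (upTo (ℓ ℕ.* ℓ ^ k)))))
                   (trans (∑-multiples ℓ (ℓ ^ k) f) (∑-cong (upTo (ℓ ^ k)) f[ℓi]≡)) ⟩
    T (suc k) j + G k j ∎
    where
    open ≡-Reasoning
    f : ℕ → ℚ
    f r = δ L (θ (suc k) r ℤ.- j)
    e∸k≡ : e ∸ k ≡ suc (e ∸ suc k)
    e∸k≡ = ℕP.+-∸-assoc 1 k<e
    regroup : ∀ l i n q j → (l ℤ.* i ℤ.* n) ℤ.* q ℤ.- j ≡ (i ℤ.* n) ℤ.* (l ℤ.* q) ℤ.- j
    regroup = solve-∀
    f[ℓi]≡ : ∀ i → f (ℓ ℕ.* i) ≡ δ L (θ k i ℤ.- j)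
    f[ℓi]≡ i = cong (δ L) (begin
      (+ (ℓ ℕ.* i) ℤ.* n) ℤ.* + (ℓ ^ (e ∸ suc k)) ℤ.- j
        ≡⟨ cong (λ z → (z ℤ.* n) ℤ.* + (ℓ ^ (e ∸ suc k)) ℤ.- j) (ℤP.pos-* ℓ i) ⟩
      (+ ℓ ℤ.* + i ℤ.* n) ℤ.* + (ℓ ^ (e ∸ suc k)) ℤ.- j
        ≡⟨ regroup (+ ℓ) (+ i) n (+ (ℓ ^ (e ∸ suc k))) j ⟩
      (+ i ℤ.* n) ℤ.* (+ ℓ ℤ.* + (ℓ ^ (e ∸ suc k))) ℤ.- j
        ≡⟨ cong (λ z → (+ i ℤ.* n) ℤ.* z ℤ.- j) (trans (sym (ℤP.pos-* ℓ _)) (cong (λ d → + (ℓ ^ d)) (sym e∸k≡))) ⟩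
      θ k i ℤ.- j ∎)

  ∑T≡G-G : ∀ D → D ≤ e → ∀ j → ∑ (map suc (upTo D)) (λ k → T k j) ≡ G D j - G 0 j
  ∑T≡G-G zero _ j = sym (ℚP.+-inverseʳ (G 0 j))
  ∑T≡G-G (suc D) D<e j = begin
    ∑ (map suc (upTo (suc D))) (λ k → T k j)
      ≡⟨ ∑-map suc (upTo (suc D)) (λ k → T k j) ⟩
    ∑ (upTo (suc D)) (λ k → T (suc k) j)
      ≡⟨ ∑-upTo-suc D (λ k → T (suc k) j) ⟩
    ∑ (upTo D) (λ k → T (suc k) j) + T (suc D) j
      ≡⟨ cong (_+ T (suc D) j) (trans (sym (∑-map suc (upTo D) (λ k → T k j))) (∑T≡G-G D (ℕP.<⇒≤ D<e) j)) ⟩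
    (G D j - G 0 j) + T (suc D) j
      ≡⟨ solve 3 (λ a b t → (a :+ (:- b)) :+ t := (t :+ a) :+ (:- b)) refl (G D j) (G 0 j) (T (suc D) j) ⟩
    (T (suc D) j + G D j) - G 0 j
      ≡⟨ cong (_- G 0 j) (G-suc D<e j) ⟨
    G (suc D) j - G 0 j ∎
    where open ≡-Reasoning

  G-zero : ∀ j → G 0 j ≡ δ L (+ 0 ℤ.- j)
  G-zero j = trans (ℚP.+-identityʳ _) (cong (δ L) (cong (ℤ._- j) (ℤP.*-zeroˡ (+ (ℓ ^ e)))))

  G-divisible : ∀ {D} → D ≤ e → + (ℓ ^ D) ℤS.∣ n → ∀ j → G D j ≡ ι (ℓ ^ D) * δ L (+ 0 ℤ.- j)
  G-divisible {D} D≤e (ℤS.divides q n≡qℓ^D) j = begin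
    ∑ (upTo (ℓ ^ D)) (λ r → δ L (θ D r ℤ.- j))
      ≡⟨ ∑-cong (upTo (ℓ ^ D)) (λ r → δ-cong-mod L (θ≡0 r)) ⟩
    ∑ (upTo (ℓ ^ D)) (λ _ → δ L (+ 0 ℤ.- j))
      ≡⟨ ∑-const (upTo (ℓ ^ D)) _ ⟩
    ι (length (upTo (ℓ ^ D))) * δ L (+ 0 ℤ.- j)
      ≡⟨ cong (λ k → ι k * δ L (+ 0 ℤ.- j)) (ListP.length-upTo (ℓ ^ D)) ⟩
    ι (ℓ ^ D) * δ L (+ 0 ℤ.- j) ∎
    where
    open ≡-Reasoning
    regroup : ∀ r q a p j → (r ℤ.* (q ℤ.* a)) ℤ.* p ℤ.- j ℤ.- (+ 0 ℤ.- j) ≡ (r ℤ.* q) ℤ.* (a ℤ.* p)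
    regroup = solve-∀
    θ≡0 : ∀ r → + L ℤS.∣ (θ D r ℤ.- j ℤ.- (+ 0 ℤ.- j))
    θ≡0 r = ℤS.divides (+ r ℤ.* q)
      (trans (cong (λ z → (+ r ℤ.* z) ℤ.* + (ℓ ^ (e ∸ D)) ℤ.- j ℤ.- (+ 0 ℤ.- j)) n≡qℓ^D)
      (trans (regroup (+ r) q (+ (ℓ ^ D)) (+ (ℓ ^ (e ∸ D))) j)
             (cong ((+ r ℤ.* q) ℤ.*_) (trans (sym (ℤP.pos-* (ℓ ^ D) _)) (cong +_ (^-split ℓ D≤e))))))

  Σθ : ℕ → Cyc
  Σθ D = Σζ^ (upTo (ℓ ^ D)) (θ D)

  coeffℤ-Σθ : ∀ D j → coeffℤ L (Σθ D) j ≡ G D j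
  coeffℤ-Σθ D j =
    trans (⟪⟫-Σ (upTo (ℓ ^ D)) _ _) (∑-cong (upTo (ℓ ^ D)) (λ r → ⟪⟫-ζ^ (θ D r) (λ a → δ L (a ℤ.- j))))

  G-shift : ∀ {D} → D ≤ e → ∀ j → G D (j ℤ.+ θ D 1) ≡ G D j
  G-shift {D} D≤e j = begin
    ∑ (upTo (ℓ ^ D)) (λ r → δ L (θ D r ℤ.- (j ℤ.+ θ D 1)))
      ≡⟨ ∑-cong (upTo (ℓ ^ D)) (λ r → cong (δ L) (e₁ (+ r) n (+ p) j)) ⟩
    ∑ (upTo (ℓ ^ D)) (λ r → f (+ r ℤ.* s ℤ.- s))
      ≡⟨ ∑-cyclic (ℓ ^ D) {{ℕP.m^n≢0 ℓ D}} f s f-periodic ⟩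
    ∑ (upTo (ℓ ^ D)) (λ r → f (+ r ℤ.* s))
      ≡⟨ ∑-cong (upTo (ℓ ^ D)) (λ r → cong (δ L) (e₂ (+ r) n (+ p) j)) ⟩
    G D j ∎
    where
    open ≡-Reasoning
    p = ℓ ^ (e ∸ D)
    s = n ℤ.* + p
    f : ℤ → ℚ
    f x = δ L (x ℤ.- j)
    e₁ : ∀ r n p j → (r ℤ.* n) ℤ.* p ℤ.- (j ℤ.+ (+ 1 ℤ.* n) ℤ.* p) ≡ (r ℤ.* (n ℤ.* p) ℤ.- n ℤ.* p) ℤ.- j
    e₁ = solve-∀
    e₂ : ∀ r n p j → r ℤ.* (n ℤ.* p) ℤ.- j ≡ (r ℤ.* n) ℤ.* p ℤ.- j
    e₂ = solve-∀
    e₃ : ∀ x N n p j → (x ℤ.+ N ℤ.* (n ℤ.* p) ℤ.- j) ℤ.- (x ℤ.- j) ≡ n ℤ.* (N ℤ.* p)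
    e₃ = solve-∀
    f-periodic : ∀ x → f (x ℤ.+ + (ℓ ^ D) ℤ.* s) ≡ f x
    f-periodic x = δ-cong-mod L (ℤS.divides n (trans (e₃ x (+ (ℓ ^ D)) n (+ p) j)
      (cong (n ℤ.*_) (trans (sym (ℤP.pos-* (ℓ ^ D) p)) (cong +_ (^-split ℓ D≤e))))))

  G-representable : ∀ {D} P .{{_ : NonZero P}} → D ≤ e → ∀ t β → t ℤ.* θ D 1 ℤ.+ β ℤ.* + L ≡ + P →
    ∃ λ h → ∀ j → G D j ≡ coeffℤ P h j
  G-representable {D} P D≤e t β tθ+βL≡P =
    proj₁ rep , λ j → trans (sym (coeffℤ-Σθ D j)) (proj₂ rep j)
    where
    g = coeffℤ L (Σθ D)
    regroup : ∀ j a b → j ℤ.+ (a ℤ.+ b) ≡ (j ℤ.+ a) ℤ.+ b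
    regroup = solve-∀
    P-periodic : ∀ j → g (j ℤ.+ + P) ≡ g j
    P-periodic j = begin
      g (j ℤ.+ + P)                                   ≡⟨ cong (λ z → g (j ℤ.+ z)) tθ+βL≡P ⟨
      g (j ℤ.+ (t ℤ.* θ D 1 ℤ.+ β ℤ.* + L))            ≡⟨ cong g (regroup j _ _) ⟩
      g ((j ℤ.+ t ℤ.* θ D 1) ℤ.+ β ℤ.* + L)            ≡⟨ periodic-* g (+ L) (coeffℤ-+L L (Σθ D)) β _ ⟩
      g (j ℤ.+ t ℤ.* θ D 1)                           ≡⟨ periodic-* g (θ D 1) shift t j ⟩
      g j                                             ∎
      where
      open ≡-Reasoning
      shift : ∀ j → g (j ℤ.+ θ D 1) ≡ g j
      shift j = trans (coeffℤ-Σθ D _) (trans (G-shift D≤e j) (sym (coeffℤ-Σθ D j)))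
    rep = periodic⇒coeffℤ L P (Σθ D) P-periodic

∑-↭ : ∀ {A : Set} {xs ys : List A} f → xs ↭ ys → ∑ xs f ≡ ∑ ys f
∑-↭ f ↭.refl = refl
∑-↭ f (↭.prep x xs↭ys) = cong (λ t → f x + t) (∑-↭ f xs↭ys)
∑-↭ f (↭.swap x y xs↭ys) = trans (cong (λ t → f x + (f y + t)) (∑-↭ f xs↭ys))
                                (solve 3 (λ a b c → a :+ (b :+ c) := b :+ (a :+ c)) refl (f x) (f y) _)
∑-↭ f (↭.trans xs↭ys ys↭zs) = trans (∑-↭ f xs↭ys) (∑-↭ f ys↭zs)

∑-Unique : ∀ {A : Set} {xs ys : List A} f → Unique xs → Unique ys → (∀ {x} → x ∈ xs ⇔ x ∈ ys) → ∑ xs f ≡ ∑ ys f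
∑-Unique f xs! ys! xs≈ys = ∑-↭ f (∼bag⇒↭ (unique∧set⇒bag xs! ys! xs≈ys))

oneTo : ℕ → List ℕ
oneTo D = map suc (upTo D)

oneTo-Unique : ∀ D → Unique (oneTo D)
oneTo-Unique D = Unique.map⁺ ℕP.suc-injective (Unique.upTo⁺ D)

∈-oneTo : ∀ {D k} → k ∈ oneTo D ⇔ (1 ≤ k × k ≤ D)
∈-oneTo {D} {k} = mk⇔ to from
  where
  to : k ∈ oneTo D → 1 ≤ k × k ≤ D
  to k∈ with ∈P.∈-map⁻ suc k∈
  ... | i , i∈ , refl = s≤s z≤n , ∈P.∈-upTo⁻ i∈
  from : 1 ≤ k × k ≤ D → k ∈ oneTo D
  from (s≤s z≤n , k≤D) = ∈P.∈-map⁺ suc (∈P.∈-upTo⁺ k≤D)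

-- The set X_ℓ

module _ {F : Poly} {ℓ e' k : ℕ} (ℓ-prime : Prime ℓ) (1≤k : 1 ≤ k) (k≤e : k ≤ suc e') where

  private
    instance
      ℓ≢0 : NonZero ℓ
      ℓ≢0 = prime⇒nonZero ℓ-prime
    p = ℓ ^ (suc e' ∸ k)
    open Cyclotomic ℓ e'
    a : ℕ → ℤ
    a v = (+ 1 ℤ.* eval F (+ v)) ℤ.* + p
    S = Σζ^ (unitsMod ℓ k) a
    n²≡φ² : ι (length (unitsMod ℓ k) ℕ.* length (unitsMod ℓ k)) ≡ ι (φ (ℓ ^ k) ℕ.* φ (ℓ ^ k))
    n²≡φ² = cong (λ n → ι (n ℕ.* n)) (length-unitsMod ℓ-prime 1≤k)
    a-a≡ : ∀ v → a v ℤ.- a 1 ≡ (eval F (+ v) ℤ.- eval F (+ 1)) ℤ.* + p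
    a-a≡ v = factor (eval F (+ v)) (eval F (+ 1)) (+ p)
      where
      factor : ∀ a b p → (+ 1 ℤ.* a) ℤ.* p ℤ.- (+ 1 ℤ.* b) ℤ.* p ≡ (a ℤ.- b) ℤ.* p
      factor = solve-∀

  constOnUnits⇒InX : ConstOnUnits F ℓ k → InX F ℓ (suc e') k
  constOnUnits⇒InX onUnits = subst (Eq ℓ (suc e') (S ⊗ conj S)) (cong const n²≡φ²)
    (≡mod⇒∣Σζ^∣²≡n² (unitsMod ℓ k) a (a 1) λ {v} v∈ → lift-∣ (onUnits v∈))
    where
    lift-∣ : ∀ {v} → + (ℓ ^ k) ℤS.∣ (eval F (+ v) ℤ.- eval F (+ 1)) → + L ℤS.∣ (a v ℤ.- a 1)
    lift-∣ {v} (ℤS.divides q eq) = ℤS.divides q (trans (a-a≡ v)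
      (trans (cong (ℤ._* + p) eq) (trans (ℤP.*-assoc q _ _)
             (cong (q ℤ.*_) (trans (sym (ℤP.pos-* (ℓ ^ k) p)) (cong +_ (^-split ℓ k≤e)))))))

  InX⇒constOnUnits : InX F ℓ (suc e') k → ConstOnUnits F ℓ k
  InX⇒constOnUnits norm {v} v∈ = ℤS.∣ᵤ⇒∣ (ℕD.*-cancelʳ-∣ p {{ℕP.m^n≢0 ℓ (suc e' ∸ k)}} ℓ^k*p∣)
    where
    ℓ^k*p∣ : ℓ ^ k ℕ.* p ∣ ℤ.∣ eval F (+ v) ℤ.- eval F (+ 1) ∣ ℕ.* p
    ℓ^k*p∣ = subst₂ _∣_ (sym (^-split ℓ k≤e))
      (trans (cong ℤ.∣_∣ (a-a≡ v)) (ℤP.abs-* (eval F (+ v) ℤ.- eval F (+ 1)) (+ p)))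
      (∣Σζ^∣²≡n²⇒≡mod (1<ℓ ℓ-prime) (unitsMod ℓ k) a
        (subst (Eq ℓ (suc e') (S ⊗ conj S)) (cong const (sym n²≡φ²)) norm) v∈ (1∈unitsMod ℓ-prime 1≤k))

-- The sum over X_ℓ

module SumOverX (F : Poly) {q M : ℕ} (w : ℤ) (J : ℕ) (isM : IsM F q M)
  {ℓ : ℕ} (ℓ-prime : Prime ℓ) {e' : ℕ} (ℓ^e∣q : ℓ ^ suc e' ∣ q) (ℓ^1+e∤q : ¬ (ℓ ^ suc (suc e') ∣ q))
  (D : ℕ) (ℓ^D∣M : ℓ ^ D ∣ M) (ℓ^1+D∤M : ¬ (ℓ ^ suc D ∣ M))
  {X : List ℕ} (X! : Unique X) (X≈ : ∀ k → (k ∈ X) ⇔ (1 ≤ k × k ≤ suc e' × InX F ℓ (suc e') k)) where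

  instance
    ℓ≢0 : NonZero ℓ
    ℓ≢0 = prime⇒nonZero ℓ-prime

  open Cyclotomic ℓ e'
  open Layers F w ℓ (suc e') J hiding (L)

  M∣q : M ∣ q
  M∣q = proj₁ (proj₂ isM)

  good : GoodMod F M
  good = proj₁ (proj₂ (proj₂ isM))

  total : Cyc
  total = Σ[ X ] (λ k → H F w ℓ (suc e') k J)

  m : ℕ
  m = ℕD._∣_.quotient ℓ^D∣M

  M≡mℓ^D : M ≡ m ℕ.* ℓ ^ D
  M≡mℓ^D = ℕD._∣_.equality ℓ^D∣M

  ℓ∤m : ¬ ℓ ∣ m
  ℓ∤m ℓ∣m = ℓ^1+D∤M (subst (ℓ ℕ.* ℓ ^ D ∣_) (sym M≡mℓ^D) (ℕD.*-monoˡ-∣ (ℓ ^ D) ℓ∣m))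

  D≤e : D ≤ suc e'
  D≤e = ℕP.≮⇒≥ λ e<D → ℓ^1+e∤q (ℕD.∣-trans (^-monoʳ-∣ ℓ e<D) (ℕD.∣-trans ℓ^D∣M M∣q))

  X≈oneTo : ∀ {k} → k ∈ X ⇔ k ∈ oneTo D
  X≈oneTo {k} = mk⇔
    (λ k∈X → let (1≤k , k≤e , inX) = Equivalence.to (X≈ k) k∈X in
      Equivalence.from ∈-oneTo (1≤k , constOnUnits⇒≤ {F = F} ℓ-prime M≡mℓ^D ℓ∤m isM ℓ^e∣q 1≤k k≤e
                                        (InX⇒constOnUnits {F = F} ℓ-prime 1≤k k≤e inX)))
    (λ k∈oneTo → let (1≤k , k≤D) = Equivalence.to ∈-oneTo k∈oneTo in
      Equivalence.from (X≈ k) (1≤k , ℕP.≤-trans k≤D D≤e , constOnUnits⇒InX {F = F} ℓ-prime 1≤k (ℕP.≤-trans k≤D D≤e)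
                                        (constOnUnits-≤ {F = F} ℓ-prime M≡mℓ^D ℓ∤m good 1≤k k≤D)))

  coeffℤ-total : ∀ j → coeffℤ L total j ≡ G D j - G 0 j
  coeffℤ-total j = begin
    coeffℤ L total j
      ≡⟨ ⟪⟫-Σ X (λ k → H F w ℓ (suc e') k J) (λ a → δ L (a ℤ.- j)) ⟩
    ∑ X (λ k → coeffℤ L (H F w ℓ (suc e') k J) j)
      ≡⟨ ∑-Unique (λ k → coeffℤ L (H F w ℓ (suc e') k J) j) X! (oneTo-Unique D) X≈oneTo ⟩
    ∑ (oneTo D) (λ k → coeffℤ L (H F w ℓ (suc e') k J) j)
      ≡⟨ ∑-cong-∈ (oneTo D) H≡T ⟩
    ∑ (oneTo D) (λ k → T k j)
      ≡⟨ ∑T≡G-G D D≤e j ⟩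
    G D j - G 0 j ∎
    where
    open ≡-Reasoning
    H≡T : ∀ {k} → k ∈ oneTo D → coeffℤ L (H F w ℓ (suc e') k J) j ≡ T k j
    H≡T k∈ = let (1≤k , k≤D) = Equivalence.to ∈-oneTo k∈ in
      coeffℤ-H (ℕP.≤-trans k≤D D≤e) (constOnUnits-≤ {F = F} ℓ-prime M≡mℓ^D ℓ∤m good 1≤k k≤D) 1≤k ℓ-prime j

  δ₀ : ℤ → ℚ
  δ₀ j = δ L (+ 0 ℤ.- j)

  divisible : + (ℓ ^ D) ℤS.∣ n → Eq ℓ (suc e') total (const ((+ (ℓ ^ D) ℤ.- + 1) ℚ./ 1))
  divisible ℓ^D∣n = Eq-intro total (const ((+ (ℓ ^ D) ℤ.- + 1) ℚ./ 1)) [] λ j → begin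
    coeffℤ L total j
      ≡⟨ coeffℤ-total j ⟩
    G D j - G 0 j
      ≡⟨ cong₂ _-_ (G-divisible D≤e ℓ^D∣n j) (G-zero j) ⟩
    ι (ℓ ^ D) * δ₀ j - δ₀ j
      ≡⟨ solve 2 (λ a d → a :* d :+ (:- d) := ((a :+ (:- con 1ℚ)) :* d :+ con 0ℚ) :+ con 0ℚ) refl (ι (ℓ ^ D)) (δ₀ j) ⟩
    ((ι (ℓ ^ D) - 1ℚ) * δ₀ j + 0ℚ) + 0ℚ
      ≡⟨ cong (λ c → (c * δ₀ j + 0ℚ) + 0ℚ) (ιℤ-+ (+ (ℓ ^ D)) (ℤ.- + 1)) ⟨
    (ιℤ (+ (ℓ ^ D) ℤ.- + 1) * δ₀ j + 0ℚ) + 0ℚ ∎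
    where open ≡-Reasoning

  G-representable-∤ : ¬ (+ (ℓ ^ D)) ℤD.∣ n → ∃ λ h → ∀ j → G D j ≡ coeffℤ P h j
  G-representable-∤ ℓ^D∤n =
    let (t , β , tnℓ^[e-D]+βL≡P) = ∤⇒ℓ^e′-combination n ℓ-prime D≤e ℓ^D∤n in
    G-representable P D≤e t β
      (trans (cong (λ z → t ℤ.* (z ℤ.* + (ℓ ^ (suc e' ∸ D))) ℤ.+ β ℤ.* + L) (ℤP.*-identityˡ n)) tnℓ^[e-D]+βL≡P)

  not-divisible : ¬ (+ (ℓ ^ D)) ℤD.∣ n → Eq ℓ (suc e') total (const (ℤ.- (+ 1) ℚ./ 1))
  not-divisible ℓ^D∤n = let (h , G≡h) = G-representable-∤ ℓ^D∤n in
    Eq-intro total (const (ℤ.- (+ 1) ℚ./ 1)) h λ j → begin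
    coeffℤ L total j
      ≡⟨ coeffℤ-total j ⟩
    G D j - G 0 j
      ≡⟨ cong₂ _-_ (G≡h j) (G-zero j) ⟩
    coeffℤ P h j - δ₀ j
      ≡⟨ solve 2 (λ c d → c :+ (:- d) := ((:- con 1ℚ) :* d :+ con 0ℚ) :+ c) refl (coeffℤ P h j) (δ₀ j) ⟩
    (- 1ℚ * δ₀ j + 0ℚ) + coeffℤ P h j ∎
    where open ≡-Reasoning

  vanishes : ¬ ℓ ∣ M → Eq ℓ (suc e') total (const 0ℚ)
  vanishes ℓ∤M = subst (λ d → Eq ℓ (suc e') total (const ((+ (ℓ ^ d) ℤ.- + 1) ℚ./ 1))) D≡0
    (divisible (subst (λ d → + (ℓ ^ d) ℤS.∣ n) (sym D≡0) (ℤS.∣ᵤ⇒∣ (ℕD.1∣ _))))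
    where
    D≡0 : D ≡ 0
    D≡0 = ^∣∧∤⇒≡0 ℓ^D∣M ℓ∤M

lemma4p3 : (F : Poly) → Nonconstant F → (q : ℕ) → 1 ≤ q → (w : ℤ) → (J : ℕ) → 1 ≤ J →
    (M : ℕ) → IsM F q M →
    (ℓ : ℕ) → Prime ℓ → ℓ ∣ q →
    (e : ℕ) → 1 ≤ e → ℓ ^ e ∣ q → ¬ (ℓ ^ suc e ∣ q) →
    (D : ℕ) → ℓ ^ D ∣ M → ¬ (ℓ ^ suc D ∣ M) →
    (X : List ℕ) → Unique X → (∀ k → (k ∈ X) ⇔ (1 ≤ k × k ≤ e × InX F ℓ e k)) →
    let total = Σ[ X ] (λ k → H F w ℓ e k J) in
    (¬ (ℓ ∣ M) → Eq ℓ e total (const ℚ.0ℚ))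
    × (ℓ ∣ M → (+ (ℓ ^ D)) ℤD.∣ (eval F (+ 1) ℤ.* + J ℤ.- w) →
    Eq ℓ e total (const ((+ (ℓ ^ D) ℤ.- + 1) ℚ./ 1)))
    × (ℓ ∣ M → ¬ ((+ (ℓ ^ D)) ℤD.∣ (eval F (+ 1) ℤ.* + J ℤ.- w)) →
    Eq ℓ e total (const (ℤ.- (+ 1) ℚ./ 1)))
lemma4p3 F _ q _ w J _ M isM ℓ ℓ-prime _ (suc e') _ ℓ^e∣q ℓ^1+e∤q D ℓ^D∣M ℓ^1+D∤M X X! X≈ =
  vanishes , (λ _ ℓ^D∣n → divisible (ℤS.∣ᵤ⇒∣ ℓ^D∣n)) , (λ _ → not-divisible)
  where open SumOverX F w J isM ℓ-prime ℓ^e∣q ℓ^1+e∤q D ℓ^D∣M ℓ^1+D∤M X! X≈
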